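{- Let $S\subseteq\mathbb{Z}^+$, $r\ge0$ and $\mu\in\mathbb{Z}$. Then, as formal power series in $t$, $$\sum_{n=0}^\infty\mathbb{B}_{n,S,r}^{(\mu)}\frac{t^n}{n!}=\big(E_{S-\vec{1}}(-t)\big)^r\,\frac{\mathrm{Li}_\mu\big(-E_S(-t)\big)}{ -E_S(-t)}.$$
   Context: ${n\brace k}_{S,r}$ is the number of partitions of $[n+r]$ into $k+r$ non-empty blocks with $1,\dots,r$ in distinct blocks and all block sizes in $S$. The $(S,r)$-poly-Bernoulli numbers are $\mathbb{B}_{n,S,r}^{(\mu)}=\sum_{k=0}^n{n\brace k}_{S,r}\frac{(-1)^{n-k}k!}{(k+1)^\mu}$. $E_S(t)=\sum_{s\in S}\frac{t^s}{s!}$ and $E_{S-\vec{1}}(t)=\sum_{s\in S}\frac{t^{s-1}}{(s-1)!}$. $\mathrm{Li}_\mu(u)=\sum_{n\ge1}u^n/n^\mu$, and $\mathrm{Li}_\mu(u)/u$ denotes the formal series $\sum_{k\ge0}u^k/(k+1)^\mu$. -}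

module Defs where

open import Data.Bool using (Bool; true; false; if_then_else_; _∧_; _∨_; not)
open import Data.Nat as ℕ using (ℕ; zero; suc; _∸_; _!)
open import Data.Nat.Properties using (m^n≢0; _!≢0)
open import Data.Integer as ℤ using (ℤ; +_; -[1+_])
open import Data.Fin using (Fin; toℕ; _≟_)
open import Data.List using (List; []; _∷_; map; concatMap; filter; length; take; allFin)
open import Data.Bool.ListAction using (all; any)
open import Data.Vec as V using (Vec; []; _∷_; toList)
open import Data.Rational using (ℚ; _+_; _*_; -_; 0ℚ; 1ℚ; _/_)
open import Relation.Nullary.Decidable using (⌊_⌋)

-- A partition of {0,…,m-1} into j non-empty blocks corresponds bijectively
-- to a vector v : Vec (Fin j) m (v[i] = index of the block containing i)
-- which is surjective and "restricted growth" (blocks numbered in order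
-- of their minimal elements: v[i] ≤ 1 + max(v[0..i-1]), v[0] = 0).

allVecs : (m j : ℕ) → List (Vec (Fin j) m)
allVecs zero    j = [] ∷ []
allVecs (suc m) j = concatMap (λ v → map (λ b → b ∷ v) (allFin j)) (allVecs m j)

-- restricted growth, with c = number of block labels used so far
rgFrom : ∀ {j m} → ℕ → Vec (Fin j) m → Bool
rgFrom c []       = true
rgFrom c (x ∷ xs) =
  if ⌊ toℕ x ℕ.<? c ⌋ then rgFrom c xs
  else if ⌊ toℕ x ℕ.≟ c ⌋ then rgFrom (suc c) xs
  else false

isRG : ∀ {j m} → Vec (Fin j) m → Bool
isRG = rgFrom 0

blockSize : ∀ {j} → List (Fin j) → Fin j → ℕ
blockSize []       b = 0
blockSize (x ∷ xs) b = if ⌊ x ≟ b ⌋ then suc (blockSize xs b) else blockSize xs b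

surj : ∀ {j m} → Vec (Fin j) m → Bool
surj {j} v = all (λ b → any (λ x → ⌊ x ≟ b ⌋) (toList v)) (allFin j)

distinct : ∀ {j} → List (Fin j) → Bool
distinct []       = true
distinct (x ∷ xs) = not (any (λ y → ⌊ x ≟ y ⌋) xs) ∧ distinct xs

Subset : Set
Subset = ℕ → Bool

-- is v a partition of [n+r] (positions 0..n+r-1; element i+1 ↦ position i)
-- into k+r blocks, with 1,…,r in distinct blocks, all block sizes in S?
isSRPartition : (S : Subset) (n k r : ℕ) → Vec (Fin (k ℕ.+ r)) (n ℕ.+ r) → Bool
isSRPartition S n k r v =
  isRG v ∧ surj v ∧ distinct (take r (toList v))
  ∧ all (λ b → S (blockSize (toList v) b)) (allFin (k ℕ.+ r))

stirlingSr : (S : Subset) (r n k : ℕ) → ℕ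
stirlingSr S r n k = length (filter (λ v → isSRPartition S n k r v T.≟ true) (allVecs (n ℕ.+ r) (k ℕ.+ r)))
  where import Data.Bool.Properties as T

ℕtoℚ : ℕ → ℚ
ℕtoℚ n = (+ n) / 1

invPow : ℕ → ℤ → ℚ
invPow k (+ m)     = _/_ (+ 1) (suc k ℕ.^ m) {{m^n≢0 (suc k) m}}
invPow k -[1+ m ]  = ℕtoℚ (suc k ℕ.^ suc m)

sgn : ℕ → ℚ
sgn zero          = 1ℚ
sgn (suc zero)    = - 1ℚ
sgn (suc (suc n)) = sgn n

invFact : ℕ → ℚ
invFact n = _/_ (+ 1) (n !) {{n !≢0}}

sumTo : ℕ → (ℕ → ℚ) → ℚ
sumTo zero    f = f 0
sumTo (suc n) f = sumTo n f + f (suc n)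

polyBernoulli : (S : Subset) (r : ℕ) (μ : ℤ) (n : ℕ) → ℚ
polyBernoulli S r μ n =
  sumTo n (λ k → ℕtoℚ (stirlingSr S r n k) * sgn (n ∸ k) * ℕtoℚ (k !) * invPow k μ)

FPS : Set
FPS = ℕ → ℚ

_⊛_ : FPS → FPS → FPS
(f ⊛ g) n = sumTo n (λ i → f i * g (n ∸ i))

_^ˢ_ : FPS → ℕ → FPS
(f ^ˢ zero) zero    = 1ℚ
(f ^ˢ zero) (suc n) = 0ℚ
(f ^ˢ suc k)        = f ⊛ (f ^ˢ k)

negS : FPS → FPS
negS f n = - f n

atNeg : FPS → FPS
atNeg f n = sgn n * f n

-- composition a(g(t)) = Σ_k a_k g(t)^k; only meaningful when g 0 = 0,
-- in which case the coefficient of t^n only involves k ≤ n.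
compose : FPS → FPS → FPS
compose a g n = sumTo n (λ k → a k * (g ^ˢ k) n)

ES : Subset → FPS
ES S n = if S n then invFact n else 0ℚ

-- E_{S-1}(t) = Σ_{s∈S} t^{s-1}/(s-1)!
ESm1 : Subset → FPS
ESm1 S n = if S (suc n) then invFact n else 0ℚ

-- Li_μ(u)/u = Σ_{k≥0} u^k/(k+1)^μ
LiOverU : ℤ → FPS
LiOverU μ k = invPow k μ

egf : (ℕ → ℚ) → FPS
egf b n = b n * invFact n

module Submission where

-- Write j = k + r.  Defs encodes a partition counted by {n brace k}_{S,r}
-- as a restricted-growth word of length n+r over Fin j.  Its first r
-- letters, being distinct, are forced to be 0, …, r-1 (ForcedPrefix); the
-- rest is a word of length n continuing a state in which r blocks are
-- opened with one letter each.  The central counting result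
-- (BlockGrowth.N-egf) gives the EGF of such continuations from any state:
-- the counts and the coefficients of an explicit product of series obey
-- the same recurrence, by classifying the first letter on one side and by
-- formal differentiation on the other (Series, FinSums).  Specialised, it
-- gives the column EGF Σ_n {n brace k}_{S,r} tⁿ/n! = E_{S-1}(t)^r E_S(t)^k/k!
-- (StirlingColumn).  Expanding Li_μ(u)/u = Σ_k u^k/(k+1)^μ at u = -E_S(-t),
-- the signs from t ↦ -t (Substitution) make both sides agree summand by
-- summand (PolyBernoulliEGF); the theorem is assembled at the end.

open import Defs
open import Data.Nat as ℕ using (ℕ; zero; suc; _∸_; _!; z≤n; s≤s)
import Data.Nat.Properties as ℕᵖ
open import Data.Fin as Fin using (Fin; zero; suc; toℕ; fromℕ<)
import Data.Fin.Properties as Finᵖ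
open import Data.Bool using (Bool; true; false; if_then_else_; _∧_; _∨_; not)
open import Data.Bool.ListAction using (all; any; and)
import Data.Bool.Properties as Boolᵖ
open import Data.Sum using (inj₁; inj₂; [_,_]′)
open import Data.List using (List; []; _∷_; _++_; map; concatMap; filter; length; tabulate; allFin; take)
import Data.List.Properties as Listᵖ
open import Data.List.Membership.Propositional using (_∈_; _∉_)
open import Data.List.Membership.Propositional.Properties using (∈-++⁺ˡ; ∈-++⁺ʳ; ∈-++⁻)
open import Data.List.Relation.Unary.Any using (here; there)
open import Data.Vec using (Vec; []; _∷_; toList)
open import Data.Vec.Functional using (updateAt)
open import Data.Vec.Functional.Properties using (updateAt-updates; updateAt-minimal)
open import Relation.Nullary using (Dec; yes; no; ¬_)
open import Relation.Nullary.Decidable using (⌊_⌋; dec⇒maybe; dec-true; dec-false; isYes≗does)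
open import Relation.Binary.PropositionalEquality using (_≡_; _≢_; refl; sym; trans; cong; cong₂; cong-app; subst; _≗_; _→-setoid_; module ≡-Reasoning)
open import Algebra.Bundles using (Semiring; CommutativeRing)
open import Level using (0ℓ)
import Algebra.Properties.Semiring.Sum as SemiringSum

module Decisions where
  ⌊⌋-yes : ∀ {p} {P : Set p} (d : Dec P) → P → ⌊ d ⌋ ≡ true
  ⌊⌋-yes d p = trans (isYes≗does d) (dec-true d p)

  ⌊⌋-sound : ∀ {p} {P : Set p} (d : Dec P) → ⌊ d ⌋ ≡ true → P
  ⌊⌋-sound (yes p) _ = p

  ⌊⌋-no : ∀ {p} {P : Set p} (d : Dec P) → ¬ P → ⌊ d ⌋ ≡ false
  ⌊⌋-no d ¬p = trans (isYes≗does d) (dec-false d ¬p)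

  ≟-suc : ∀ a b → ⌊ suc a ℕ.≟ suc b ⌋ ≡ ⌊ a ℕ.≟ b ⌋
  ≟-suc a b with a ℕ.≟ b
  ... | yes a≡b = ⌊⌋-yes (suc a ℕ.≟ suc b) (cong suc a≡b)
  ... | no  a≢b = ⌊⌋-no (suc a ℕ.≟ suc b) (λ e → a≢b (ℕᵖ.suc-injective e))

  <?-suc : ∀ a b → ⌊ suc a ℕ.<? suc b ⌋ ≡ ⌊ a ℕ.<? b ⌋
  <?-suc a b with a ℕ.<? b
  ... | yes a<b = ⌊⌋-yes (suc a ℕ.<? suc b) (s≤s a<b)
  ... | no  a≮b = ⌊⌋-no (suc a ℕ.<? suc b) (λ h → a≮b (ℕᵖ.≤-pred h))

  <?-suc-≢ : ∀ a c → a ≢ c → ⌊ a ℕ.<? suc c ⌋ ≡ ⌊ a ℕ.<? c ⌋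
  <?-suc-≢ a c a≢c with a ℕ.<? c
  ... | yes a<c = ⌊⌋-yes (a ℕ.<? suc c) (ℕᵖ.m<n⇒m<1+n a<c)
  ... | no  a≮c = ⌊⌋-no (a ℕ.<? suc c) (λ a<1+c → [ a≮c , a≢c ]′ (ℕᵖ.m≤n⇒m<n∨m≡n (ℕᵖ.≤-pred a<1+c)))

module Pick {c ℓ} (R : Semiring c ℓ) where
  open Semiring R using (Carrier; _≈_; _+_; 0#; setoid; +-congˡ; +-identityˡ; +-identityʳ) renaming (refl to ≈-refl)
  open SemiringSum R using (sum; sum-cong-≗; sum-replicate-zero)
  open import Relation.Binary.Reasoning.Setoid setoid
  open Decisions using (≟-suc)

  pick : ∀ {k} → ℕ → (Fin k → Carrier) → Fin k → Carrier
  pick c G x = if ⌊ toℕ x ℕ.≟ c ⌋ then G x else 0#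

  private
    pick-suc : ∀ {k} c (G : Fin (suc k) → Carrier) → (λ x → pick (suc c) G (suc x)) ≗ pick c (λ x → G (suc x))
    pick-suc c G x = cong (λ b → if b then G (suc x) else 0#) (≟-suc (toℕ x) c)

  sum-pick : ∀ {k} c (c<k : c ℕ.< k) (G : Fin k → Carrier) → sum (pick c G) ≈ G (fromℕ< c<k)
  sum-pick {suc k} zero    c<k G = begin
    G zero + sum {k} (λ _ → 0#) ≈⟨ +-congˡ (sum-replicate-zero k) ⟩
    G zero + 0#                 ≈⟨ +-identityʳ (G zero) ⟩
    G zero                      ∎
  sum-pick {suc k} (suc c) c<k G = begin
    0# + sum (λ x → pick (suc c) G (suc x)) ≈⟨ +-identityˡ _ ⟩
    sum (λ x → pick (suc c) G (suc x))      ≡⟨ sum-cong-≗ (pick-suc c G) ⟩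
    sum (pick c (λ x → G (suc x)))          ≈⟨ sum-pick c (ℕ.s<s⁻¹ c<k) (λ x → G (suc x)) ⟩
    G (suc (fromℕ< (ℕ.s<s⁻¹ c<k)))          ∎

  sum-pick-none : ∀ {k} c → k ℕ.≤ c → (G : Fin k → Carrier) → sum (pick c G) ≈ 0#
  sum-pick-none {zero}  c       k≤c G = ≈-refl
  sum-pick-none {suc k} (suc c) k≤c G = begin
    0# + sum (λ x → pick (suc c) G (suc x)) ≈⟨ +-identityˡ _ ⟩
    sum (λ x → pick (suc c) G (suc x))      ≡⟨ sum-cong-≗ (pick-suc c G) ⟩
    sum (pick c (λ x → G (suc x)))          ≈⟨ sum-pick-none c (ℕᵖ.≤-pred k≤c) (λ x → G (suc x)) ⟩
    0#                                      ∎

-- The rational numbers enter only now: the generic lemmas above open a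
-- semiring's operators, which the rational ones would shadow.
open import Data.Integer as ℤ using (ℤ; +_)
import Data.Integer.Properties as ℤᵖ
open import Data.Rational using (ℚ; _+_; _*_; -_; 0ℚ; 1ℚ; _/_; toℚᵘ)
import Data.Rational.Properties as ℚᵖ
open import Data.Rational.Properties using (+-comm; +-assoc; *-comm; *-assoc; +-identityˡ; +-identityʳ; *-identityˡ; *-identityʳ; *-zeroˡ; *-zeroʳ; *-distribˡ-+; *-distribʳ-+)
open import Data.Rational.Unnormalised as ℚᵘ using (mkℚᵘ; *≡*)
import Data.Rational.Unnormalised.Properties as ℚᵘᵖ
import Relation.Binary.Reasoning.Setoid
open import Tactic.RingSolver using (solve-∀)
open import Tactic.RingSolver.Core.AlmostCommutativeRing using (AlmostCommutativeRing; fromCommutativeRing)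

ℚ-ring : AlmostCommutativeRing 0ℓ 0ℓ
ℚ-ring = fromCommutativeRing ℚᵖ.+-*-commutativeRing (λ x → dec⇒maybe (0ℚ ℚᵖ.≟ x))

-- The embedding ℕ → ℚ is a semiring homomorphism; we compute through the
-- unnormalised representation, where n/1 is literally mkℚᵘ (+ n) 0.
module Embedding where
  private
    toℚᵘ-/ : ∀ a d .{{_ : ℕ.NonZero d}} → toℚᵘ ((+ a) / d) ℚᵘ.≃ mkℚᵘ (+ a) (ℕ.pred d)
    toℚᵘ-/ a (suc d) = ℚᵖ.toℚᵘ-fromℚᵘ (mkℚᵘ (+ a) d)

  ℕtoℚ-+ : ∀ a b → ℕtoℚ (a ℕ.+ b) ≡ ℕtoℚ a + ℕtoℚ b
  ℕtoℚ-+ a b = ℚᵖ.toℚᵘ-injective (ℚᵘᵖ.≃-trans (toℚᵘ-/ (a ℕ.+ b) 1)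
    (ℚᵘᵖ.≃-sym (ℚᵘᵖ.≃-trans (ℚᵖ.toℚᵘ-homo-+ (ℕtoℚ a) (ℕtoℚ b))
      (ℚᵘᵖ.≃-trans (ℚᵘᵖ.+-cong (toℚᵘ-/ a 1) (toℚᵘ-/ b 1)) (*≡* cross)))))
    where
    cross : (+ a ℤ.* + 1 ℤ.+ + b ℤ.* + 1) ℤ.* + 1 ≡ + (a ℕ.+ b) ℤ.* + 1
    cross = begin
      (+ a ℤ.* + 1 ℤ.+ + b ℤ.* + 1) ℤ.* + 1 ≡⟨ ℤᵖ.*-identityʳ _ ⟩
      + a ℤ.* + 1 ℤ.+ + b ℤ.* + 1           ≡⟨ cong₂ ℤ._+_ (ℤᵖ.*-identityʳ (+ a)) (ℤᵖ.*-identityʳ (+ b)) ⟩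
      + a ℤ.+ + b                           ≡⟨ sym (ℤᵖ.pos-+ a b) ⟩
      + (a ℕ.+ b)                           ≡⟨ sym (ℤᵖ.*-identityʳ _) ⟩
      + (a ℕ.+ b) ℤ.* + 1                   ∎
      where open ≡-Reasoning

  ℕtoℚ-* : ∀ a b → ℕtoℚ (a ℕ.* b) ≡ ℕtoℚ a * ℕtoℚ b
  ℕtoℚ-* a b = ℚᵖ.toℚᵘ-injective (ℚᵘᵖ.≃-trans (toℚᵘ-/ (a ℕ.* b) 1)
    (ℚᵘᵖ.≃-sym (ℚᵘᵖ.≃-trans (ℚᵖ.toℚᵘ-homo-* (ℕtoℚ a) (ℕtoℚ b))
      (ℚᵘᵖ.≃-trans (ℚᵘᵖ.*-cong (toℚᵘ-/ a 1) (toℚᵘ-/ b 1)) (*≡* cross)))))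
    where
    cross : (+ a ℤ.* + b) ℤ.* + 1 ≡ + (a ℕ.* b) ℤ.* + 1
    cross = trans (ℤᵖ.*-identityʳ _) (trans (sym (ℤᵖ.pos-* a b)) (sym (ℤᵖ.*-identityʳ _)))

  ℕtoℚ-inverse : ∀ d .{{_ : ℕ.NonZero d}} → ℕtoℚ d * ((+ 1) / d) ≡ 1ℚ
  ℕtoℚ-inverse (suc d) = ℚᵖ.toℚᵘ-injective (ℚᵘᵖ.≃-trans (ℚᵖ.toℚᵘ-homo-* (ℕtoℚ (suc d)) ((+ 1) / suc d))
    (ℚᵘᵖ.≃-trans (ℚᵘᵖ.*-cong (toℚᵘ-/ (suc d) 1) (toℚᵘ-/ 1 (suc d))) (*≡* cross)))
    where
    cross : (+ suc d ℤ.* + 1) ℤ.* + 1 ≡ + 1 ℤ.* + (1 ℕ.* suc d)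
    cross = trans (ℤᵖ.*-identityʳ _) (trans (ℤᵖ.*-identityʳ _)
              (trans (cong +_ (sym (ℕᵖ.*-identityˡ (suc d)))) (sym (ℤᵖ.*-identityˡ _))))

  fact-invFact : ∀ n → ℕtoℚ (n !) * invFact n ≡ 1ℚ
  fact-invFact n = ℕtoℚ-inverse (n !) {{n ℕᵖ.!≢0}}

  -- (m+1) / (m+1)! = 1 / m!: the coefficient identity behind differentiating an EGF.
  invFact-suc : ∀ m → ℕtoℚ (suc m) * invFact (suc m) ≡ invFact m
  invFact-suc m = begin
    A * f               ≡⟨ sym (*-identityʳ _) ⟩
    (A * f) * 1ℚ        ≡⟨ cong ((A * f) *_) (sym (fact-invFact m)) ⟩
    (A * f) * (M * g)   ≡⟨ regroup A f M g ⟩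
    ((A * M) * f) * g   ≡⟨ cong (λ z → (z * f) * g) (sym (ℕtoℚ-* (suc m) (m !))) ⟩
    (ℕtoℚ (suc m !) * f) * g ≡⟨ cong (_* g) (fact-invFact (suc m)) ⟩
    1ℚ * g              ≡⟨ *-identityˡ g ⟩
    g                   ∎
    where
    open ≡-Reasoning
    A : ℚ
    A = ℕtoℚ (suc m)
    f : ℚ
    f = invFact (suc m)
    g : ℚ
    g = invFact m
    M : ℚ
    M = ℕtoℚ (m !)
    regroup : ∀ (a f m g : ℚ) → (a * f) * (m * g) ≡ ((a * m) * f) * g
    regroup = solve-∀ ℚ-ring

  ℕtoℚ-suc-cancel : ∀ m {a b} → ℕtoℚ (suc m) * a ≡ ℕtoℚ (suc m) * b → a ≡ b
  ℕtoℚ-suc-cancel m {a} {b} eq = begin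
    a               ≡⟨ sym (*-identityˡ a) ⟩
    1ℚ * a          ≡⟨ cong (_* a) (sym inv) ⟩
    (i * A) * a     ≡⟨ *-assoc i A a ⟩
    i * (A * a)     ≡⟨ cong (i *_) eq ⟩
    i * (A * b)     ≡⟨ sym (*-assoc i A b) ⟩
    (i * A) * b     ≡⟨ cong (_* b) inv ⟩
    1ℚ * b          ≡⟨ *-identityˡ b ⟩
    b               ∎
    where
    open ≡-Reasoning
    A : ℚ
    A = ℕtoℚ (suc m)
    i : ℚ
    i = (+ 1) / suc m
    inv : i * A ≡ 1ℚ
    inv = trans (*-comm i A) (ℕtoℚ-inverse (suc m))

module Signs where
  open import Algebra.Properties.Group ℚᵖ.+-0-group using () renaming (⁻¹-involutive to neg-involutive)

  sgn-suc : ∀ n → sgn (suc n) ≡ - sgn n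
  sgn-suc zero    = refl
  sgn-suc (suc n) = trans (sym (neg-involutive (sgn n))) (cong -_ (sym (sgn-suc n)))

  sgn-+ : ∀ a b → sgn (a ℕ.+ b) ≡ sgn a * sgn b
  sgn-+ zero    b = sym (*-identityˡ (sgn b))
  sgn-+ (suc a) b = begin
    sgn (suc a ℕ.+ b)     ≡⟨ sgn-suc (a ℕ.+ b) ⟩
    - sgn (a ℕ.+ b)       ≡⟨ cong -_ (sgn-+ a b) ⟩
    - (sgn a * sgn b)     ≡⟨ ℚᵖ.neg-distribˡ-* (sgn a) (sgn b) ⟩
    - sgn a * sgn b       ≡⟨ cong (_* sgn b) (sym (sgn-suc a)) ⟩
    sgn (suc a) * sgn b   ∎
    where open ≡-Reasoning

  sgn-square : ∀ n → sgn n * sgn n ≡ 1ℚ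
  sgn-square zero    = refl
  sgn-square (suc n) = begin
    sgn (suc n) * sgn (suc n) ≡⟨ cong (λ z → z * z) (sgn-suc n) ⟩
    - sgn n * - sgn n         ≡⟨ negate-both (sgn n) ⟩
    sgn n * sgn n             ≡⟨ sgn-square n ⟩
    1ℚ                        ∎
    where
    open ≡-Reasoning
    negate-both : ∀ (x : ℚ) → - x * - x ≡ x * x
    negate-both = solve-∀ ℚ-ring

  -- (-1)^(n-k) = (-1)^n (-1)^k, since (-1)^k is its own inverse.
  sgn-∸ : ∀ n k → k ℕ.≤ n → sgn (n ∸ k) ≡ sgn n * sgn k
  sgn-∸ n k k≤n = begin
    sgn (n ∸ k)                   ≡⟨ sym (*-identityʳ (sgn (n ∸ k))) ⟩
    sgn (n ∸ k) * 1ℚ              ≡⟨ cong (sgn (n ∸ k) *_) (sym (sgn-square k)) ⟩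
    sgn (n ∸ k) * (sgn k * sgn k) ≡⟨ sym (*-assoc (sgn (n ∸ k)) (sgn k) (sgn k)) ⟩
    (sgn (n ∸ k) * sgn k) * sgn k ≡⟨ cong (_* sgn k) (sym (sgn-+ (n ∸ k) k)) ⟩
    sgn (n ∸ k ℕ.+ k) * sgn k     ≡⟨ cong (λ z → sgn z * sgn k) (ℕᵖ.m∸n+n≡m k≤n) ⟩
    sgn n * sgn k                 ∎
    where open ≡-Reasoning

module RangeSums where
  open ≡-Reasoning

  sumTo-cong≤ : ∀ n {f g : ℕ → ℚ} → (∀ i → i ℕ.≤ n → f i ≡ g i) → sumTo n f ≡ sumTo n g
  sumTo-cong≤ zero    h = h 0 z≤n
  sumTo-cong≤ (suc n) h = cong₂ _+_ (sumTo-cong≤ n (λ i i≤n → h i (ℕᵖ.m≤n⇒m≤1+n i≤n))) (h (suc n) ℕᵖ.≤-refl)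

  sumTo-cong : ∀ n {f g : ℕ → ℚ} → (∀ i → f i ≡ g i) → sumTo n f ≡ sumTo n g
  sumTo-cong n h = sumTo-cong≤ n (λ i _ → h i)

  sumTo-bound : ∀ {m m'} (f : ℕ → ℚ) → m ≡ m' → sumTo m f ≡ sumTo m' f
  sumTo-bound f refl = refl

  sumTo-zero : ∀ n {f : ℕ → ℚ} → (∀ i → i ℕ.≤ n → f i ≡ 0ℚ) → sumTo n f ≡ 0ℚ
  sumTo-zero n h = trans (sumTo-cong≤ n h) (constant-zero n)
    where
    constant-zero : ∀ n → sumTo n (λ _ → 0ℚ) ≡ 0ℚ
    constant-zero zero    = refl
    constant-zero (suc n) = cong (_+ 0ℚ) (constant-zero n)

  sumTo-+ : ∀ n (f g : ℕ → ℚ) → sumTo n (λ i → f i + g i) ≡ sumTo n f + sumTo n g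
  sumTo-+ zero    f g = refl
  sumTo-+ (suc n) f g = trans (cong (_+ (f (suc n) + g (suc n))) (sumTo-+ n f g))
                              (interchange (sumTo n f) (sumTo n g) (f (suc n)) (g (suc n)))
    where
    interchange : ∀ (a b c d : ℚ) → (a + b) + (c + d) ≡ (a + c) + (b + d)
    interchange = solve-∀ ℚ-ring

  sumTo-*ˡ : ∀ n (a : ℚ) (f : ℕ → ℚ) → sumTo n (λ i → a * f i) ≡ a * sumTo n f
  sumTo-*ˡ zero    a f = refl
  sumTo-*ˡ (suc n) a f = trans (cong (_+ (a * f (suc n))) (sumTo-*ˡ n a f)) (sym (*-distribˡ-+ a (sumTo n f) (f (suc n))))

  sumTo-*ʳ : ∀ n (a : ℚ) (f : ℕ → ℚ) → sumTo n (λ i → f i * a) ≡ sumTo n f * a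
  sumTo-*ʳ n a f = trans (sumTo-cong n (λ i → *-comm (f i) a)) (trans (sumTo-*ˡ n a f) (*-comm a _))

  sumTo-shift : ∀ n (f : ℕ → ℚ) → sumTo (suc n) f ≡ f 0 + sumTo n (λ i → f (suc i))
  sumTo-shift zero    f = refl
  sumTo-shift (suc n) f = trans (cong (_+ f (suc (suc n))) (sumTo-shift n f)) (+-assoc (f 0) _ (f (suc (suc n))))

  sumTo-reverse : ∀ n (f : ℕ → ℚ) → sumTo n f ≡ sumTo n (λ i → f (n ∸ i))
  sumTo-reverse zero    f = refl
  sumTo-reverse (suc n) f = begin
    sumTo n f + f (suc n)                   ≡⟨ cong (_+ f (suc n)) (sumTo-reverse n f) ⟩
    sumTo n (λ i → f (n ∸ i)) + f (suc n)   ≡⟨ +-comm (sumTo n (λ i → f (n ∸ i))) (f (suc n)) ⟩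
    f (suc n) + sumTo n (λ i → f (n ∸ i))   ≡⟨ sym (sumTo-shift n (λ i → f (suc n ∸ i))) ⟩
    sumTo (suc n) (λ i → f (suc n ∸ i))     ∎

  sumTo-swap : ∀ n m (h : ℕ → ℕ → ℚ) →
    sumTo n (λ i → sumTo m (λ j → h i j)) ≡ sumTo m (λ j → sumTo n (λ i → h i j))
  sumTo-swap zero    m h = refl
  sumTo-swap (suc n) m h = trans (cong (_+ sumTo m (h (suc n))) (sumTo-swap n m h))
                                 (sym (sumTo-+ m (λ j → sumTo n (λ i → h i j)) (h (suc n))))

  sumTo-truncate : ∀ a n {f : ℕ → ℚ} → a ℕ.≤ n → (∀ i → a ℕ.< i → i ℕ.≤ n → f i ≡ 0ℚ) → sumTo n f ≡ sumTo a f
  sumTo-truncate a n a≤n h with ℕᵖ.m≤n⇒m<n∨m≡n a≤n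
  ... | inj₂ refl = refl
  sumTo-truncate a (suc n) a≤n h | inj₁ (s≤s a≤n') =
    trans (cong₂ _+_ (sumTo-truncate a n a≤n' (λ i a<i i≤n → h i a<i (ℕᵖ.m≤n⇒m≤1+n i≤n))) (h (suc n) (s≤s a≤n') ℕᵖ.≤-refl))
          (+-identityʳ _)

  sumTo-triangle : ∀ n (h : ℕ → ℕ → ℚ) →
    sumTo n (λ i → sumTo i (λ a → h a i)) ≡ sumTo n (λ a → sumTo (n ∸ a) (λ b → h a (a ℕ.+ b)))
  sumTo-triangle zero    h = refl
  sumTo-triangle (suc n) h = sym (begin
    sumTo n (λ a → sumTo (suc n ∸ a) (λ b → h a (a ℕ.+ b))) + sumTo (suc n ∸ suc n) (λ b → h (suc n) (suc n ℕ.+ b))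
      ≡⟨ cong₂ _+_ (sumTo-cong≤ n lastRow)
                   (trans (sumTo-bound _ (ℕᵖ.n∸n≡0 n)) (cong (h (suc n)) (ℕᵖ.+-identityʳ (suc n)))) ⟩
    sumTo n (λ a → R a + h a (suc n)) + h (suc n) (suc n)
      ≡⟨ cong (_+ h (suc n) (suc n)) (sumTo-+ n R (λ a → h a (suc n))) ⟩
    (sumTo n R + sumTo n (λ a → h a (suc n))) + h (suc n) (suc n)
      ≡⟨ +-assoc (sumTo n R) (sumTo n (λ a → h a (suc n))) (h (suc n) (suc n)) ⟩
    sumTo n R + sumTo (suc n) (λ a → h a (suc n))
      ≡⟨ cong (_+ sumTo (suc n) (λ a → h a (suc n))) (sym (sumTo-triangle n h)) ⟩
    sumTo n (λ i → sumTo i (λ a → h a i)) + sumTo (suc n) (λ a → h a (suc n)) ∎)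
    where
    R : ℕ → ℚ
    R a = sumTo (n ∸ a) (λ b → h a (a ℕ.+ b))
    lastRow : ∀ a → a ℕ.≤ n → sumTo (suc n ∸ a) (λ b → h a (a ℕ.+ b)) ≡ R a + h a (suc n)
    lastRow a a≤n = trans (sumTo-bound _ (ℕᵖ.+-∸-assoc 1 a≤n))
      (cong (_+_ (R a)) (cong (h a) (trans (ℕᵖ.+-suc a (n ∸ a)) (cong suc (ℕᵖ.m+[n∸m]≡n a≤n)))))

module Series where
  open RangeSums
  module ≈-Reasoning = Relation.Binary.Reasoning.Setoid (ℕ →-setoid ℚ)

  1ˢ : FPS
  1ˢ zero    = 1ℚ
  1ˢ (suc n) = 0ℚ

  0ˢ : FPS
  0ˢ _ = 0ℚ

  infixl 6 _⊕_
  _⊕_ : FPS → FPS → FPS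
  (f ⊕ g) n = f n + g n

  infixr 7 _·ˢ_
  _·ˢ_ : ℚ → FPS → FPS
  (a ·ˢ f) n = a * f n

  D : FPS → FPS
  D f n = ℕtoℚ (suc n) * f (suc n)

  ⊕-cong : ∀ {f f' g g'} → f ≗ f' → g ≗ g' → (f ⊕ g) ≗ (f' ⊕ g')
  ⊕-cong p q n = cong₂ _+_ (p n) (q n)

  -- The fixed operand is explicit: both operations compute, so it could
  -- not be recovered from the coefficients by unification.
  ⊕-congˡ : ∀ f {g g'} → g ≗ g' → (f ⊕ g) ≗ (f ⊕ g')
  ⊕-congˡ f q = ⊕-cong {f} {f} (λ _ → refl) q

  ·ˢ-cong : ∀ a {f g} → f ≗ g → (a ·ˢ f) ≗ (a ·ˢ g)
  ·ˢ-cong a p n = cong (a *_) (p n)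

  ⊛-cong : ∀ {f f' g g'} → f ≗ f' → g ≗ g' → (f ⊛ g) ≗ (f' ⊛ g')
  ⊛-cong p q n = sumTo-cong n (λ i → cong₂ _*_ (p i) (q (n ∸ i)))

  ⊛-congˡ : ∀ f {g g'} → g ≗ g' → (f ⊛ g) ≗ (f ⊛ g')
  ⊛-congˡ f q = ⊛-cong {f} {f} (λ _ → refl) q

  ⊛-congʳ : ∀ g {f f'} → f ≗ f' → (f ⊛ g) ≗ (f' ⊛ g)
  ⊛-congʳ g p = ⊛-cong {g = g} {g' = g} p (λ _ → refl)

  ⊛-comm : ∀ f g → (f ⊛ g) ≗ (g ⊛ f)
  ⊛-comm f g n = trans (sumTo-reverse n (λ i → f i * g (n ∸ i)))
    (sumTo-cong≤ n (λ i i≤n → trans (cong (λ k → f (n ∸ i) * g k) (ℕᵖ.m∸[m∸n]≡n i≤n)) (*-comm (f (n ∸ i)) (g i))))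

  ⊛-assoc : ∀ f g h → ((f ⊛ g) ⊛ h) ≗ (f ⊛ (g ⊛ h))
  ⊛-assoc f g h n = begin
    sumTo n (λ i → sumTo i (λ a → f a * g (i ∸ a)) * h (n ∸ i))
      ≡⟨ sumTo-cong n (λ i → sym (sumTo-*ʳ i (h (n ∸ i)) (λ a → f a * g (i ∸ a)))) ⟩
    sumTo n (λ i → sumTo i (λ a → f a * g (i ∸ a) * h (n ∸ i)))
      ≡⟨ sumTo-triangle n (λ a i → f a * g (i ∸ a) * h (n ∸ i)) ⟩
    sumTo n (λ a → sumTo (n ∸ a) (λ b → f a * g ((a ℕ.+ b) ∸ a) * h (n ∸ (a ℕ.+ b))))
      ≡⟨ sumTo-cong n (λ a → sumTo-cong (n ∸ a) (λ b →
           trans (cong₂ (λ u v → f a * g u * h v) (ℕᵖ.m+n∸m≡n a b) (sym (ℕᵖ.∸-+-assoc n a b)))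
                 (*-assoc (f a) (g b) (h (n ∸ a ∸ b))))) ⟩
    sumTo n (λ a → sumTo (n ∸ a) (λ b → f a * (g b * h (n ∸ a ∸ b))))
      ≡⟨ sumTo-cong n (λ a → sumTo-*ˡ (n ∸ a) (f a) (λ b → g b * h (n ∸ a ∸ b))) ⟩
    sumTo n (λ a → f a * sumTo (n ∸ a) (λ b → g b * h (n ∸ a ∸ b))) ∎
    where open ≡-Reasoning

  ⊛-identityˡ : ∀ f → (1ˢ ⊛ f) ≗ f
  ⊛-identityˡ f zero    = *-identityˡ (f 0)
  ⊛-identityˡ f (suc n) = begin
    sumTo (suc n) (λ i → 1ˢ i * f (suc n ∸ i))         ≡⟨ sumTo-shift n (λ i → 1ˢ i * f (suc n ∸ i)) ⟩
    1ℚ * f (suc n) + sumTo n (λ i → 0ℚ * f (n ∸ i))    ≡⟨ cong₂ _+_ (*-identityˡ (f (suc n)))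
                                                            (sumTo-zero n (λ i _ → *-zeroˡ (f (n ∸ i)))) ⟩
    f (suc n) + 0ℚ                                     ≡⟨ +-identityʳ _ ⟩
    f (suc n)                                          ∎
    where open ≡-Reasoning

  ⊛-zeroˡ : ∀ f → (0ˢ ⊛ f) ≗ 0ˢ
  ⊛-zeroˡ f n = sumTo-zero n (λ i _ → *-zeroˡ (f (n ∸ i)))

  ⊛-zeroʳ : ∀ f → (f ⊛ 0ˢ) ≗ 0ˢ
  ⊛-zeroʳ f n = sumTo-zero n (λ i _ → *-zeroʳ (f i))

  ⊛-·ˢʳ : ∀ a f g → (f ⊛ (a ·ˢ g)) ≗ (a ·ˢ (f ⊛ g))
  ⊛-·ˢʳ a f g n = trans (sumTo-cong n (λ i → swap (f i) a (g (n ∸ i)))) (sumTo-*ˡ n a (λ i → f i * g (n ∸ i)))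
    where
    swap : ∀ (x a y : ℚ) → x * (a * y) ≡ a * (x * y)
    swap = solve-∀ ℚ-ring

  ⊛-distribʳ : ∀ f g h → ((f ⊕ g) ⊛ h) ≗ ((f ⊛ h) ⊕ (g ⊛ h))
  ⊛-distribʳ f g h n = trans (sumTo-cong n (λ i → *-distribʳ-+ (h (n ∸ i)) (f i) (g i))) (sumTo-+ n _ _)

  ^ˢ-zero : ∀ f → (f ^ˢ 0) ≗ 1ˢ
  ^ˢ-zero f zero    = refl
  ^ˢ-zero f (suc n) = refl

  ^ˢ-cong : ∀ {f g} k → f ≗ g → (f ^ˢ k) ≗ (g ^ˢ k)
  ^ˢ-cong zero    p = λ { zero → refl ; (suc n) → refl }
  ^ˢ-cong (suc k) p = ⊛-cong p (^ˢ-cong k p)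

  D-cong : ∀ {f g} → f ≗ g → D f ≗ D g
  D-cong p n = cong (ℕtoℚ (suc n) *_) (p (suc n))

  D-·ˢ : ∀ a f → D (a ·ˢ f) ≗ (a ·ˢ D f)
  D-·ˢ a f n = swap (ℕtoℚ (suc n)) a (f (suc n))
    where
    swap : ∀ (c a x : ℚ) → c * (a * x) ≡ a * (c * x)
    swap = solve-∀ ℚ-ring

  D-1ˢ : D 1ˢ ≗ 0ˢ
  D-1ˢ n = *-zeroʳ (ℕtoℚ (suc n))

  -- Leibniz rule: split the weight n+1 of the i-th product term as i + (n+1-i).
  D-⊛ : ∀ f g → D (f ⊛ g) ≗ ((D f ⊛ g) ⊕ (f ⊛ D g))
  D-⊛ f g n = begin
    ℕtoℚ (suc n) * sumTo (suc n) X
      ≡⟨ sym (sumTo-*ˡ (suc n) (ℕtoℚ (suc n)) X) ⟩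
    sumTo (suc n) (λ i → ℕtoℚ (suc n) * X i)
      ≡⟨ sumTo-cong≤ (suc n) split ⟩
    sumTo (suc n) (λ i → ℕtoℚ i * X i + ℕtoℚ (suc n ∸ i) * X i)
      ≡⟨ sumTo-+ (suc n) (λ i → ℕtoℚ i * X i) (λ i → ℕtoℚ (suc n ∸ i) * X i) ⟩
    sumTo (suc n) (λ i → ℕtoℚ i * X i) + sumTo (suc n) (λ i → ℕtoℚ (suc n ∸ i) * X i)
      ≡⟨ cong₂ _+_ leftWeights rightWeights ⟩
    (D f ⊛ g) n + (f ⊛ D g) n ∎
    where
    open ≡-Reasoning
    open Embedding using (ℕtoℚ-+)
    X : ℕ → ℚ
    X i = f i * g (suc n ∸ i)
    distrib : ∀ (a b c : ℚ) → (a + b) * c ≡ a * c + b * c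
    distrib = solve-∀ ℚ-ring
    split : ∀ i → i ℕ.≤ suc n → ℕtoℚ (suc n) * X i ≡ ℕtoℚ i * X i + ℕtoℚ (suc n ∸ i) * X i
    split i i≤n = trans (cong (λ k → ℕtoℚ k * X i) (sym (ℕᵖ.m+[n∸m]≡n i≤n)))
      (trans (cong (_* X i) (ℕtoℚ-+ i (suc n ∸ i))) (distrib (ℕtoℚ i) (ℕtoℚ (suc n ∸ i)) (X i)))
    leftWeights : sumTo (suc n) (λ i → ℕtoℚ i * X i) ≡ (D f ⊛ g) n
    leftWeights = trans (sumTo-shift n (λ i → ℕtoℚ i * X i))
      (trans (cong (_+ sumTo n (λ i → ℕtoℚ (suc i) * X (suc i))) (*-zeroˡ (X 0)))
      (trans (+-identityˡ _) (sumTo-cong n (λ i → sym (*-assoc (ℕtoℚ (suc i)) (f (suc i)) (g (n ∸ i)))))))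
    rightWeights : sumTo (suc n) (λ i → ℕtoℚ (suc n ∸ i) * X i) ≡ (f ⊛ D g) n
    rightWeights = trans (cong₂ _+_ (sumTo-cong≤ n inner) (trans (cong (λ k → ℕtoℚ k * X (suc n)) (ℕᵖ.n∸n≡0 n)) (*-zeroˡ (X (suc n)))))
                         (+-identityʳ _)
      where
      swap : ∀ (c a x : ℚ) → c * (a * x) ≡ a * (c * x)
      swap = solve-∀ ℚ-ring
      inner : ∀ i → i ℕ.≤ n → ℕtoℚ (suc n ∸ i) * X i ≡ f i * (ℕtoℚ (suc (n ∸ i)) * g (suc (n ∸ i)))
      inner i i≤n = trans (cong (λ k → ℕtoℚ k * (f i * g k)) (ℕᵖ.+-∸-assoc 1 i≤n)) (swap (ℕtoℚ (suc (n ∸ i))) (f i) (g (suc (n ∸ i))))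

  D-^ˢ : ∀ f k → D (f ^ˢ suc k) ≗ (ℕtoℚ (suc k) ·ˢ (D f ⊛ (f ^ˢ k)))
  D-^ˢ f zero = begin
    D (f ⊛ (f ^ˢ 0))                        ≈⟨ D-⊛ f (f ^ˢ 0) ⟩
    (D f ⊛ (f ^ˢ 0)) ⊕ (f ⊛ D (f ^ˢ 0))     ≈⟨ ⊕-congˡ (D f ⊛ (f ^ˢ 0)) (⊛-congˡ f (λ n → trans (D-cong (^ˢ-zero f) n) (D-1ˢ n))) ⟩
    (D f ⊛ (f ^ˢ 0)) ⊕ (f ⊛ 0ˢ)             ≈⟨ ⊕-congˡ (D f ⊛ (f ^ˢ 0)) (⊛-zeroʳ f) ⟩
    (D f ⊛ (f ^ˢ 0)) ⊕ 0ˢ                   ≈⟨ (λ n → trans (+-identityʳ ((D f ⊛ (f ^ˢ 0)) n)) (sym (*-identityˡ ((D f ⊛ (f ^ˢ 0)) n)))) ⟩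
    1ℚ ·ˢ (D f ⊛ (f ^ˢ 0))                  ∎
    where open ≈-Reasoning
  D-^ˢ f (suc k) = begin
    D (f ⊛ (f ^ˢ suc k))
      ≈⟨ D-⊛ f (f ^ˢ suc k) ⟩
    (D f ⊛ (f ^ˢ suc k)) ⊕ (f ⊛ D (f ^ˢ suc k))
      ≈⟨ ⊕-congˡ L (⊛-congˡ f (D-^ˢ f k)) ⟩
    (D f ⊛ (f ^ˢ suc k)) ⊕ (f ⊛ (K ·ˢ (D f ⊛ (f ^ˢ k))))
      ≈⟨ ⊕-congˡ L (⊛-·ˢʳ K f (D f ⊛ (f ^ˢ k))) ⟩
    (D f ⊛ (f ^ˢ suc k)) ⊕ (K ·ˢ (f ⊛ (D f ⊛ (f ^ˢ k))))
      ≈⟨ ⊕-congˡ L (·ˢ-cong K rotate) ⟩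
    (D f ⊛ (f ^ˢ suc k)) ⊕ (K ·ˢ (D f ⊛ (f ^ˢ suc k)))
      ≈⟨ (λ n → trans (one-plus _ K) (cong (_* (D f ⊛ (f ^ˢ suc k)) n) (sym (Embedding.ℕtoℚ-+ 1 (suc k))))) ⟩
    ℕtoℚ (suc (suc k)) ·ˢ (D f ⊛ (f ^ˢ suc k)) ∎
    where
    open ≈-Reasoning
    K : ℚ
    K = ℕtoℚ (suc k)
    L : FPS
    L = D f ⊛ (f ^ˢ suc k)
    one-plus : ∀ (x a : ℚ) → x + a * x ≡ (1ℚ + a) * x
    one-plus = solve-∀ ℚ-ring
    rotate : (f ⊛ (D f ⊛ (f ^ˢ k))) ≗ (D f ⊛ (f ^ˢ suc k))
    rotate = begin
      f ⊛ (D f ⊛ (f ^ˢ k))   ≈⟨ (λ n → sym (⊛-assoc f (D f) (f ^ˢ k) n)) ⟩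
      (f ⊛ D f) ⊛ (f ^ˢ k)   ≈⟨ ⊛-congʳ (f ^ˢ k) (⊛-comm f (D f)) ⟩
      (D f ⊛ f) ⊛ (f ^ˢ k)   ≈⟨ ⊛-assoc (D f) f (f ^ˢ k) ⟩
      D f ⊛ (f ^ˢ suc k)     ∎

module FinSums where
  open Series
  module ℚΣ = SemiringSum (CommutativeRing.semiring ℚᵖ.+-*-commutativeRing)

  Σˢ : (j : ℕ) → (Fin j → FPS) → FPS
  Σˢ j A n = ℚΣ.sum (λ x → A x n)

  Σˢ-cong : ∀ j {A B : Fin j → FPS} → (∀ x → A x ≗ B x) → Σˢ j A ≗ Σˢ j B
  Σˢ-cong j h n = ℚΣ.sum-cong-≗ (λ x → h x n)

  Σˢ-⊕ : ∀ j (A B : Fin j → FPS) → Σˢ j (λ x → A x ⊕ B x) ≗ (Σˢ j A ⊕ Σˢ j B)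
  Σˢ-⊕ j A B n = ℚΣ.∑-distrib-+ (λ x → A x n) (λ x → B x n)

  ⊛-Σˢʳ : ∀ j (A : Fin j → FPS) g → (Σˢ j A ⊛ g) ≗ Σˢ j (λ x → A x ⊛ g)
  ⊛-Σˢʳ zero    A g = ⊛-zeroˡ g
  ⊛-Σˢʳ (suc j) A g n = trans (⊛-distribʳ (A zero) (Σˢ j (λ x → A (suc x))) g n)
                              (cong (_+_ ((A zero ⊛ g) n)) (⊛-Σˢʳ j (λ x → A (suc x)) g n))

  ⊛-Σˢˡ : ∀ j (A : Fin j → FPS) g → (g ⊛ Σˢ j A) ≗ Σˢ j (λ x → g ⊛ A x)
  ⊛-Σˢˡ j A g n = trans (⊛-comm g (Σˢ j A) n)
    (trans (⊛-Σˢʳ j A g n) (Σˢ-cong j (λ x → ⊛-comm (A x) g) n))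

  private
    module ℚPick = Pick (CommutativeRing.semiring ℚᵖ.+-*-commutativeRing)

    pick-coeff : ∀ k c (A : Fin k → FPS) n →
      Σˢ k (λ x → if ⌊ toℕ x ℕ.≟ c ⌋ then A x else 0ˢ) n ≡ ℚΣ.sum (ℚPick.pick c (λ x → A x n))
    pick-coeff k c A n = ℚΣ.sum-cong-≗ {k} (λ x → Boolᵖ.if-float (λ (f : FPS) → f n) ⌊ toℕ x ℕ.≟ c ⌋ {A x} {0ˢ})

  Σˢ-pick : ∀ k c (c<k : c ℕ.< k) (A : Fin k → FPS) → Σˢ k (λ x → if ⌊ toℕ x ℕ.≟ c ⌋ then A x else 0ˢ) ≗ A (fromℕ< c<k)
  Σˢ-pick k c c<k A n = trans (pick-coeff k c A n) (ℚPick.sum-pick c c<k (λ x → A x n))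

  Σˢ-pick-none : ∀ k c → k ℕ.≤ c → (A : Fin k → FPS) → Σˢ k (λ x → if ⌊ toℕ x ℕ.≟ c ⌋ then A x else 0ˢ) ≗ 0ˢ
  Σˢ-pick-none k c k≤c A n = trans (pick-coeff k c A n) (ℚPick.sum-pick-none c k≤c (λ x → A x n))

  Πˢ : (j : ℕ) → (Fin j → FPS) → FPS
  Πˢ zero    fs = 1ˢ
  Πˢ (suc j) fs = fs zero ⊛ Πˢ j (λ b → fs (suc b))

  Πˢ-cong : ∀ j {fs gs : Fin j → FPS} → (∀ b → fs b ≗ gs b) → Πˢ j fs ≗ Πˢ j gs
  Πˢ-cong zero    h = λ _ → refl
  Πˢ-cong (suc j) h = ⊛-cong (h zero) (Πˢ-cong j (λ b → h (suc b)))

  D-Πˢ : ∀ j (fs : Fin j → FPS) → D (Πˢ j fs) ≗ Σˢ j (λ x → Πˢ j (updateAt fs x D))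
  D-Πˢ zero    fs = D-1ˢ
  D-Πˢ (suc j) fs n = begin
    D (f₀ ⊛ P) n
      ≡⟨ D-⊛ f₀ P n ⟩
    (D f₀ ⊛ P) n + (f₀ ⊛ D P) n
      ≡⟨ cong (_+_ ((D f₀ ⊛ P) n)) (⊛-congˡ f₀ (D-Πˢ j fs') n) ⟩
    (D f₀ ⊛ P) n + (f₀ ⊛ Σˢ j (λ x → Πˢ j (updateAt fs' x D))) n
      ≡⟨ cong (_+_ ((D f₀ ⊛ P) n)) (⊛-Σˢˡ j (λ x → Πˢ j (updateAt fs' x D)) f₀ n) ⟩
    Σˢ (suc j) (λ x → Πˢ (suc j) (updateAt fs x D)) n ∎
    where
    open ≡-Reasoning
    f₀ : FPS
    f₀ = fs zero
    fs' : Fin j → FPS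
    fs' = λ b → fs (suc b)
    P : FPS
    P = Πˢ j fs'

  Πˢ-update-1ˢ : ∀ j (fs : Fin j → FPS) x g → fs x ≗ 1ˢ → Πˢ j (updateAt fs x (λ _ → g)) ≗ (g ⊛ Πˢ j fs)
  Πˢ-update-1ˢ (suc j) fs zero g fx≗1 = ⊛-congˡ g (λ n → sym (trans (⊛-congʳ P fx≗1 n) (⊛-identityˡ P n)))
    where
    P : FPS
    P = Πˢ j (λ b → fs (suc b))
  Πˢ-update-1ˢ (suc j) fs (suc x) g fx≗1 n = begin
    (fs zero ⊛ Πˢ j (updateAt (λ b → fs (suc b)) x (λ _ → g))) n ≡⟨ ⊛-congˡ (fs zero) (Πˢ-update-1ˢ j (λ b → fs (suc b)) x g fx≗1) n ⟩
    (fs zero ⊛ (g ⊛ P)) n                                        ≡⟨ sym (⊛-assoc (fs zero) g P n) ⟩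
    ((fs zero ⊛ g) ⊛ P) n                                        ≡⟨ ⊛-congʳ P (⊛-comm (fs zero) g) n ⟩
    ((g ⊛ fs zero) ⊛ P) n                                        ≡⟨ ⊛-assoc g (fs zero) P n ⟩
    (g ⊛ (fs zero ⊛ P)) n                                        ∎
    where
    open ≡-Reasoning
    P : FPS
    P = Πˢ j (λ b → fs (suc b))

  Πˢ-zero : ∀ j (fs : Fin j → FPS) x → fs x ≗ 0ˢ → Πˢ j fs ≗ 0ˢ
  Πˢ-zero (suc j) fs zero    fx≗0 n = trans (⊛-congʳ (Πˢ j (λ b → fs (suc b))) fx≗0 n) (⊛-zeroˡ (Πˢ j (λ b → fs (suc b))) n)
  Πˢ-zero (suc j) fs (suc x) fx≗0 n = trans (⊛-congˡ (fs zero) (Πˢ-zero j (λ b → fs (suc b)) x fx≗0) n) (⊛-zeroʳ (fs zero) n)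

  Πˢ-power : ∀ m s g → s ℕ.≤ m → Πˢ m (λ b → if ⌊ toℕ b ℕ.<? s ⌋ then g else 1ˢ) ≗ (g ^ˢ s)
  Πˢ-power zero    zero    g z≤n = λ n → sym (^ˢ-zero g n)
  Πˢ-power (suc m) zero    g _ n = trans (⊛-identityˡ (Πˢ m (λ _ → 1ˢ)) n) (Πˢ-power m zero g z≤n n)
  Πˢ-power (suc m) (suc s) g (s≤s s≤m) =
    ⊛-congˡ g (λ n → trans (Πˢ-cong m (λ b n → cong (λ β → (if β then g else 1ˢ) n) (Decisions.<?-suc (toℕ b) s)) n)
                           (Πˢ-power m s g s≤m n))

module Counting where
  module ℕΣ = SemiringSum ℕᵖ.+-*-semiring
  open import Algebra.Properties.CommutativeSemigroup ℕᵖ.+-commutativeSemigroup using (interchange)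

  ind : Bool → ℕ
  ind b = if b then 1 else 0

  -- Defs.stirlingSr S r n k is literally count (n+r) (k+r) of its test.
  count : (m j : ℕ) → (Vec (Fin j) m → Bool) → ℕ
  count m j P = length (filter (λ v → P v Boolᵖ.≟ true) (allVecs m j))

  private
    listSum : ∀ {A : Set} → List A → (A → ℕ) → ℕ
    listSum []       g = 0
    listSum (x ∷ xs) g = g x ℕ.+ listSum xs g

    listSum-cong : ∀ {A : Set} (L : List A) {g h : A → ℕ} → (∀ x → g x ≡ h x) → listSum L g ≡ listSum L h
    listSum-cong []      e = refl
    listSum-cong (x ∷ L) e = cong₂ ℕ._+_ (e x) (listSum-cong L e)

    listSum-+ : ∀ {A : Set} (L : List A) (g h : A → ℕ) → listSum L (λ x → g x ℕ.+ h x) ≡ listSum L g ℕ.+ listSum L h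
    listSum-+ []      g h = refl
    listSum-+ (x ∷ L) g h = trans (cong (g x ℕ.+ h x ℕ.+_) (listSum-+ L g h))
                                  (interchange (g x) (h x) (listSum L g) (listSum L h))

    listSum-zero : ∀ {A : Set} (L : List A) → listSum L (λ _ → 0) ≡ 0
    listSum-zero []      = refl
    listSum-zero (x ∷ L) = listSum-zero L

    listSum-concatMap : ∀ {A B : Set} (f : A → List B) (L : List A) (g : B → ℕ) →
                        listSum (concatMap f L) g ≡ listSum L (λ v → listSum (f v) g)
    listSum-concatMap f []      g = refl
    listSum-concatMap f (x ∷ L) g = trans (listSum-++ (f x) (concatMap f L)) (cong (listSum (f x) g ℕ.+_) (listSum-concatMap f L g))
      where
      listSum-++ : ∀ M N → listSum (M ++ N) g ≡ listSum M g ℕ.+ listSum N g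
      listSum-++ []      N = refl
      listSum-++ (y ∷ M) N = trans (cong (g y ℕ.+_) (listSum-++ M N)) (sym (ℕᵖ.+-assoc (g y) _ _))

    listSum-map : ∀ {A B : Set} (h : A → B) (L : List A) (g : B → ℕ) → listSum (map h L) g ≡ listSum L (λ x → g (h x))
    listSum-map h []      g = refl
    listSum-map h (x ∷ L) g = cong (g (h x) ℕ.+_) (listSum-map h L g)

    listSum-swap : ∀ {A B : Set} (L : List A) (M : List B) (g : A → B → ℕ) →
                   listSum L (λ v → listSum M (g v)) ≡ listSum M (λ b → listSum L (λ v → g v b))
    listSum-swap []      M g = sym (listSum-zero M)
    listSum-swap (x ∷ L) M g = trans (cong (listSum M (g x) ℕ.+_) (listSum-swap L M g))
                                     (sym (listSum-+ M (g x) (λ b → listSum L (λ v → g v b))))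

    listSum-tabulate : ∀ {A : Set} j (f : Fin j → A) (g : A → ℕ) → listSum (tabulate f) g ≡ ℕΣ.sum (λ x → g (f x))
    listSum-tabulate zero    f g = refl
    listSum-tabulate (suc j) f g = cong (g (f zero) ℕ.+_) (listSum-tabulate j (λ x → f (suc x)) g)

    length-filter : ∀ {A : Set} (L : List A) (P : A → Bool) → length (filter (λ v → P v Boolᵖ.≟ true) L) ≡ listSum L (λ v → ind (P v))
    length-filter []      P = refl
    length-filter (x ∷ L) P with P x
    ... | true  = cong suc (length-filter L P)
    ... | false = length-filter L P

  count-cong : ∀ m j {P Q : Vec (Fin j) m → Bool} → (∀ v → P v ≡ Q v) → count m j P ≡ count m j Q
  count-cong m j {P} {Q} e = trans (length-filter (allVecs m j) P)
    (trans (listSum-cong (allVecs m j) (λ v → cong ind (e v))) (sym (length-filter (allVecs m j) Q)))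

  count-[] : ∀ j (P : Vec (Fin j) 0 → Bool) → count 0 j P ≡ ind (P [])
  count-[] j P = trans (length-filter (allVecs 0 j) P) (ℕᵖ.+-identityʳ _)

  count-false : ∀ m j → count m j (λ _ → false) ≡ 0
  count-false m j = trans (length-filter (allVecs m j) (λ _ → false)) (listSum-zero (allVecs m j))

  count-suc : ∀ m j (P : Vec (Fin j) (suc m) → Bool) → count (suc m) j P ≡ ℕΣ.sum (λ x → count m j (λ w → P (x ∷ w)))
  count-suc m j P = begin
    count (suc m) j P
      ≡⟨ length-filter (allVecs (suc m) j) P ⟩
    listSum (concatMap (λ v → map (λ b → b ∷ v) (allFin j)) (allVecs m j)) (λ v → ind (P v))
      ≡⟨ listSum-concatMap (λ v → map (λ b → b ∷ v) (allFin j)) (allVecs m j) (λ v → ind (P v)) ⟩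
    listSum (allVecs m j) (λ v → listSum (map (λ b → b ∷ v) (allFin j)) (λ v → ind (P v)))
      ≡⟨ listSum-cong (allVecs m j) (λ v → listSum-map (λ b → b ∷ v) (allFin j) (λ v → ind (P v))) ⟩
    listSum (allVecs m j) (λ v → listSum (allFin j) (λ b → ind (P (b ∷ v))))
      ≡⟨ listSum-swap (allVecs m j) (allFin j) (λ v b → ind (P (b ∷ v))) ⟩
    listSum (allFin j) (λ b → listSum (allVecs m j) (λ v → ind (P (b ∷ v))))
      ≡⟨ listSum-tabulate j (λ x → x) (λ b → listSum (allVecs m j) (λ v → ind (P (b ∷ v)))) ⟩
    ℕΣ.sum (λ b → listSum (allVecs m j) (λ v → ind (P (b ∷ v))))
      ≡⟨ ℕΣ.sum-cong-≗ (λ b → sym (length-filter (allVecs m j) (λ v → P (b ∷ v)))) ⟩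
    ℕΣ.sum (λ x → count m j (λ w → P (x ∷ w))) ∎
    where open ≡-Reasoning

  ℕtoℚ-sum : ∀ k (f : Fin k → ℕ) → ℕtoℚ (ℕΣ.sum f) ≡ FinSums.ℚΣ.sum (λ x → ℕtoℚ (f x))
  ℕtoℚ-sum zero    f = refl
  ℕtoℚ-sum (suc k) f = trans (Embedding.ℕtoℚ-+ (f zero) (ℕΣ.sum (λ x → f (suc x)))) (cong (_+_ (ℕtoℚ (f zero))) (ℕtoℚ-sum k (λ x → f (suc x))))

module AllFacts where
  all-cong : ∀ {A : Set} (L : List A) {β γ : A → Bool} → (∀ x → β x ≡ γ x) → all β L ≡ all γ L
  all-cong []      e = refl
  all-cong (x ∷ L) e = cong₂ _∧_ (e x) (all-cong L e)

  all-mono : ∀ {A : Set} (L : List A) {β γ : A → Bool} → (∀ x → β x ≡ true → γ x ≡ true) → all β L ≡ true → all γ L ≡ true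
  all-mono []      h _ = refl
  all-mono (x ∷ L) {β} h e with β x in βx
  ... | true = cong₂ _∧_ (h x βx) (all-mono L h e)

  all-allFin-suc : ∀ k (β : Fin (suc k) → Bool) → all β (allFin (suc k)) ≡ β zero ∧ all (λ x → β (suc x)) (allFin k)
  all-allFin-suc k β = cong (λ bs → β zero ∧ and bs)
    (trans (Listᵖ.map-tabulate suc β) (sym (Listᵖ.map-tabulate (λ x → x) (λ x → β (suc x)))))

  all-allFin-false : ∀ k (β : Fin k → Bool) x → β x ≡ false → all β (allFin k) ≡ false
  all-allFin-false (suc k) β zero    βx = trans (all-allFin-suc k β) (cong (_∧ all (λ y → β (suc y)) (allFin k)) βx)
  all-allFin-false (suc k) β (suc x) βx = trans (all-allFin-suc k β)
    (trans (cong (β zero ∧_) (all-allFin-false k (λ y → β (suc y)) x βx)) (Boolᵖ.∧-zeroʳ (β zero)))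

-- A word w continues a partial
-- restricted-growth word in which c blocks are already opened and block b
-- already holds p b letters; it is admissible if it continues the growth
-- pattern and all final block sizes lie in S.  The number N c p m of
-- admissible words of length m has exponential generating function
--     G c p = Π_{b<c} T_{p b}(t) · E_S(t)^{j-c} / (j-c)!,
-- where T_a(t) = Σ_n [a+n ∈ S] tⁿ/n! completes a block already holding a
-- letters, and the j-c unopened blocks each contribute E_S(t), the 1/(j-c)!
-- accounting for the forced order in which they are opened.  Both sides
-- satisfy the same recurrence: classifying the first letter on the counting
-- side, differentiating (D) on the series side.
module BlockGrowth (S : Subset) (S0 : S 0 ≡ false) (j : ℕ) where
  open Series
  open FinSums
  open Counting
  open Decisions
  open AllFacts
  open Embedding using (invFact-suc; ℕtoℚ-suc-cancel)

  -- How many letters each block already holds.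
  Profile : Set
  Profile = Fin j → ℕ

  admissible : ℕ → Profile → ∀ {m} → Vec (Fin j) m → Bool
  admissible c p w = rgFrom c w ∧ all (λ b → S (p b ℕ.+ blockSize (toList w) b)) (allFin j)

  N : ℕ → Profile → ℕ → ℕ
  N c p m = count m j (admissible c p)

  bump : Profile → Fin j → Profile
  bump p x b = if ⌊ x Fin.≟ b ⌋ then suc (p b) else p b

  bump-here : ∀ p x → bump p x x ≡ suc (p x)
  bump-here p x = cong (λ β → if β then suc (p x) else p x) (⌊⌋-yes (x Fin.≟ x) refl)

  bump-elsewhere : ∀ p x b → x ≢ b → bump p x b ≡ p b
  bump-elsewhere p x b x≢b = cong (λ β → if β then suc (p b) else p b) (⌊⌋-no (x Fin.≟ b) x≢b)

  Unopened : ℕ → Profile → Set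
  Unopened c p = ∀ b → c ℕ.≤ toℕ b → p b ≡ 0

  bump-unopened : ∀ {c c'} p x → c ℕ.≤ c' → toℕ x ℕ.< c' → Unopened c p → Unopened c' (bump p x)
  bump-unopened p x c≤c' x<c' un b c'≤b =
    trans (bump-elsewhere p x b (λ { refl → ℕᵖ.<-irrefl refl (ℕᵖ.<-≤-trans x<c' c'≤b) })) (un b (ℕᵖ.≤-trans c≤c' c'≤b))

  -- The first letter x of a word joins an opened block (x < c), opens the
  -- next block (x = c), or breaks restricted growth; `branch` selects
  -- among three outcomes accordingly.
  choose : {A : Set} → Bool → Bool → A → A → A → A
  choose b₁ b₂ joined opened invalid = if b₁ then joined else if b₂ then opened else invalid

  branch : {A : Set} → ℕ → Fin j → A → A → A → A
  branch c x = choose ⌊ toℕ x ℕ.<? c ⌋ ⌊ toℕ x ℕ.≟ c ⌋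

  admissible-∷ : ∀ c p {m} x (w : Vec (Fin j) m) →
    admissible c p (x ∷ w) ≡ branch c x (admissible c (bump p x) w) (admissible (suc c) (bump p x) w) false
  admissible-∷ c p x w = trans (cong (rgFrom c (x ∷ w) ∧_) sizes) (distrib ⌊ toℕ x ℕ.<? c ⌋ ⌊ toℕ x ℕ.≟ c ⌋)
    where
    Z : Bool
    Z = all (λ b → S (bump p x b ℕ.+ blockSize (toList w) b)) (allFin j)
    sizes : all (λ b → S (p b ℕ.+ blockSize (x ∷ toList w) b)) (allFin j) ≡ Z
    sizes = all-cong (allFin j) (λ b → cong S (shift b))
      where
      shift : ∀ b → p b ℕ.+ blockSize (x ∷ toList w) b ≡ bump p x b ℕ.+ blockSize (toList w) b
      shift b with ⌊ x Fin.≟ b ⌋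
      ... | true  = ℕᵖ.+-suc (p b) _
      ... | false = refl
    distrib : ∀ b₁ b₂ → choose b₁ b₂ (rgFrom c w) (rgFrom (suc c) w) false ∧ Z
                      ≡ choose b₁ b₂ (rgFrom c w ∧ Z) (rgFrom (suc c) w ∧ Z) false
    distrib true  _     = refl
    distrib false true  = refl
    distrib false false = refl

  N-suc : ∀ c p m → N c p (suc m) ≡ ℕΣ.sum (λ x → branch c x (N c (bump p x) m) (N (suc c) (bump p x) m) 0)
  N-suc c p m = trans (count-suc m j (admissible c p)) (ℕΣ.sum-cong-≗ {j} (λ x →
    trans (count-cong m j (admissible-∷ c p x))
          (count-choose ⌊ toℕ x ℕ.<? c ⌋ ⌊ toℕ x ℕ.≟ c ⌋ (admissible c (bump p x)) (admissible (suc c) (bump p x)))))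
    where
    count-choose : ∀ b₁ b₂ (P Q : Vec (Fin j) m → Bool) →
      count m j (λ w → choose b₁ b₂ (P w) (Q w) false) ≡ choose b₁ b₂ (count m j P) (count m j Q) 0
    count-choose true  _     P Q = refl
    count-choose false true  P Q = refl
    count-choose false false P Q = count-false m j

  completion : ℕ → FPS
  completion a n = if S (a ℕ.+ n) then invFact n else 0ℚ

  fresh : ℕ → FPS
  fresh q = invFact q ·ˢ (ES S ^ˢ q)

  factor : ℕ → Profile → Fin j → FPS
  factor c p b = if ⌊ toℕ b ℕ.<? c ⌋ then completion (p b) else 1ˢ

  G : ℕ → Profile → FPS
  G c p = Πˢ j (factor c p) ⊛ fresh (j ∸ c)

  D-completion : ∀ a → D (completion a) ≗ completion (suc a)
  D-completion a n rewrite ℕᵖ.+-suc a n with S (suc (a ℕ.+ n))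
  ... | true  = invFact-suc n
  ... | false = *-zeroʳ (ℕtoℚ (suc n))

  -- Opening one more block: D (E_S^{q+1}/(q+1)!) = E_S' · E_S^q/q!, and E_S' = T_1.
  D-fresh : ∀ q → D (fresh (suc q)) ≗ (completion 1 ⊛ fresh q)
  D-fresh q = begin
    D (c₁ ·ˢ (ES S ^ˢ suc q))                           ≈⟨ D-·ˢ c₁ (ES S ^ˢ suc q) ⟩
    c₁ ·ˢ D (ES S ^ˢ suc q)                             ≈⟨ ·ˢ-cong c₁ (D-^ˢ (ES S) q) ⟩
    c₁ ·ˢ (ℕtoℚ (suc q) ·ˢ (D (ES S) ⊛ (ES S ^ˢ q)))    ≈⟨ (λ n → trans (reassoc c₁ (ℕtoℚ (suc q)) (L n)) (cong (_* L n) (invFact-suc q))) ⟩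
    invFact q ·ˢ (D (ES S) ⊛ (ES S ^ˢ q))               ≈⟨ ·ˢ-cong (invFact q) (⊛-congʳ (ES S ^ˢ q) (D-completion 0)) ⟩
    invFact q ·ˢ (completion 1 ⊛ (ES S ^ˢ q))           ≈⟨ (λ n → sym (⊛-·ˢʳ (invFact q) (completion 1) (ES S ^ˢ q) n)) ⟩
    completion 1 ⊛ fresh q                              ∎
    where
    open ≈-Reasoning
    c₁ : ℚ
    c₁ = invFact (suc q)
    L : FPS
    L = D (ES S) ⊛ (ES S ^ˢ q)
    reassoc : ∀ (i a x : ℚ) → i * (a * x) ≡ (a * i) * x
    reassoc = solve-∀ ℚ-ring

  D-fresh-zero : D (fresh 0) ≗ 0ˢ
  D-fresh-zero n = trans (cong (ℕtoℚ (suc n) *_) (*-zeroʳ (invFact 0))) (*-zeroʳ (ℕtoℚ (suc n)))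

  factor-opened : ∀ c p b → toℕ b ℕ.< c → factor c p b ≡ completion (p b)
  factor-opened c p b b<c = cong (λ β → if β then completion (p b) else 1ˢ) (⌊⌋-yes (toℕ b ℕ.<? c) b<c)

  factor-unopened : ∀ c p b → ¬ (toℕ b ℕ.< c) → factor c p b ≡ 1ˢ
  factor-unopened c p b b≮c = cong (λ β → if β then completion (p b) else 1ˢ) (⌊⌋-no (toℕ b ℕ.<? c) b≮c)

  factor-bump : ∀ c p x b → x ≢ b → factor c (bump p x) b ≡ factor c p b
  factor-bump c p x b x≢b = cong (λ a → if ⌊ toℕ b ℕ.<? c ⌋ then completion a else 1ˢ) (bump-elsewhere p x b x≢b)

  -- Differentiating the factor of block x: an opened block gains a letter,
  -- an unopened block's factor 1 differentiates to 0.
  D-factor : ∀ c p x → (Πˢ j (updateAt (factor c p) x D) ⊛ fresh (j ∸ c)) ≗ (if ⌊ toℕ x ℕ.<? c ⌋ then G c (bump p x) else 0ˢ)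
  D-factor c p x with toℕ x ℕ.<? c
  ... | yes x<c = ⊛-congʳ (fresh (j ∸ c)) (Πˢ-cong j joined)
    where
    joined : ∀ b → updateAt (factor c p) x D b ≗ factor c (bump p x) b
    joined b = caseOn (x Fin.≟ b)
      where
      caseOn : Dec (x ≡ b) → updateAt (factor c p) x D b ≗ factor c (bump p x) b
      caseOn (yes refl) n = begin
        updateAt (factor c p) x D x n ≡⟨ cong-app (updateAt-updates x (factor c p)) n ⟩
        D (factor c p x) n            ≡⟨ D-cong (cong-app (factor-opened c p x x<c)) n ⟩
        D (completion (p x)) n        ≡⟨ D-completion (p x) n ⟩
        completion (suc (p x)) n      ≡⟨ cong (λ a → completion a n) (sym (bump-here p x)) ⟩
        completion (bump p x x) n     ≡⟨ cong-app (sym (factor-opened c (bump p x) x x<c)) n ⟩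
        factor c (bump p x) x n       ∎
        where open ≡-Reasoning
      caseOn (no x≢b) = cong-app (trans (updateAt-minimal b x (factor c p) (λ b≡x → x≢b (sym b≡x)))
                                        (sym (factor-bump c p x b x≢b)))
  ... | no x≮c = λ n → trans (⊛-congʳ (fresh (j ∸ c)) (Πˢ-zero j _ x vanishes) n) (⊛-zeroˡ (fresh (j ∸ c)) n)
    where
    vanishes : updateAt (factor c p) x D x ≗ 0ˢ
    vanishes n = trans (cong-app (updateAt-updates x (factor c p)) n)
                       (trans (D-cong (cong-app (factor-unopened c p x x≮c)) n) (D-1ˢ n))

  open-factor : ∀ c p x₀ → toℕ x₀ ≡ c → p x₀ ≡ 0 →
    ∀ b → updateAt (factor c p) x₀ (λ _ → completion 1) b ≗ factor (suc c) (bump p x₀) b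
  open-factor c p x₀ x₀≡c empty b = caseOn (x₀ Fin.≟ b)
    where
    caseOn : Dec (x₀ ≡ b) → updateAt (factor c p) x₀ (λ _ → completion 1) b ≗ factor (suc c) (bump p x₀) b
    caseOn (yes refl) = cong-app (trans (updateAt-updates x₀ (factor c p))
        (sym (trans (factor-opened (suc c) (bump p x₀) x₀ (ℕᵖ.≤-reflexive (cong suc x₀≡c)))
                    (cong completion (trans (bump-here p x₀) (cong suc empty))))))
    caseOn (no x₀≢b) = cong-app (trans (updateAt-minimal b x₀ (factor c p) (λ b≡x₀ → x₀≢b (sym b≡x₀)))
        (sym (trans (factor-bump (suc c) p x₀ b x₀≢b)
                    (cong (λ β → if β then completion (p b) else 1ˢ)
                          (<?-suc-≢ (toℕ b) c (λ b≡c → x₀≢b (Finᵖ.toℕ-injective (trans x₀≡c (sym b≡c)))))))))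

  D-opening : ∀ c p → c ℕ.≤ j → Unopened c p →
    (Πˢ j (factor c p) ⊛ D (fresh (j ∸ c))) ≗ Σˢ j (λ x → if ⌊ toℕ x ℕ.≟ c ⌋ then G (suc c) (bump p x) else 0ˢ)
  D-opening c p c≤j un with ℕᵖ.m≤n⇒m<n∨m≡n c≤j
  ... | inj₂ refl = λ n → begin
    (P ⊛ D (fresh (c ∸ c))) n ≡⟨ ⊛-congˡ P (λ n → trans (D-cong (λ n → cong (λ q → fresh q n) (ℕᵖ.n∸n≡0 c)) n) (D-fresh-zero n)) n ⟩
    (P ⊛ 0ˢ) n                ≡⟨ ⊛-zeroʳ P n ⟩
    0ℚ                        ≡⟨ sym (Σˢ-pick-none c c ℕᵖ.≤-refl (λ x → G (suc c) (bump p x)) n) ⟩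
    _                         ∎
    where
    open ≡-Reasoning
    P : FPS
    P = Πˢ c (factor c p)
  ... | inj₁ c<j = begin
    P ⊛ D (fresh (j ∸ c))                       ≈⟨ ⊛-congˡ P (D-cong (λ n → cong (λ q → fresh q n) j∸c≡1+q)) ⟩
    P ⊛ D (fresh (suc q))                       ≈⟨ ⊛-congˡ P (D-fresh q) ⟩
    P ⊛ (completion 1 ⊛ fresh q)                ≈⟨ (λ n → sym (⊛-assoc P (completion 1) (fresh q) n)) ⟩
    (P ⊛ completion 1) ⊛ fresh q                ≈⟨ ⊛-congʳ (fresh q) (⊛-comm P (completion 1)) ⟩
    (completion 1 ⊛ P) ⊛ fresh q                ≈⟨ ⊛-congʳ (fresh q) (λ n → sym (Πˢ-update-1ˢ j (factor c p) x₀ (completion 1) x₀-unopened n)) ⟩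
    Πˢ j (updateAt (factor c p) x₀ (λ _ → completion 1)) ⊛ fresh q
                                                ≈⟨ ⊛-congʳ (fresh q) (Πˢ-cong j (open-factor c p x₀ x₀≡c (un x₀ (ℕᵖ.≤-reflexive (sym x₀≡c))))) ⟩
    G (suc c) (bump p x₀)                       ≈⟨ (λ n → sym (Σˢ-pick j c c<j (λ x → G (suc c) (bump p x)) n)) ⟩
    Σˢ j (λ x → if ⌊ toℕ x ℕ.≟ c ⌋ then G (suc c) (bump p x) else 0ˢ) ∎
    where
    open ≈-Reasoning
    P : FPS
    P = Πˢ j (factor c p)
    q : ℕ
    q = j ∸ suc c
    j∸c≡1+q : j ∸ c ≡ suc q
    j∸c≡1+q = ℕᵖ.+-∸-assoc 1 c<j
    x₀ : Fin j
    x₀ = fromℕ< c<j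
    x₀≡c : toℕ x₀ ≡ c
    x₀≡c = Finᵖ.toℕ-fromℕ< c<j
    x₀-unopened : factor c p x₀ ≗ 1ˢ
    x₀-unopened = cong-app (factor-unopened c p x₀ (λ x₀<c → ℕᵖ.<-irrefl x₀≡c x₀<c))

  -- The series-side recurrence, matching N-suc term by term.
  D-G : ∀ c p → c ℕ.≤ j → Unopened c p →
    D (G c p) ≗ Σˢ j (λ x → branch c x (G c (bump p x)) (G (suc c) (bump p x)) 0ˢ)
  D-G c p c≤j un = begin
    D (P ⊛ Q)                                   ≈⟨ D-⊛ P Q ⟩
    (D P ⊛ Q) ⊕ (P ⊛ D Q)                       ≈⟨ ⊕-cong joining (D-opening c p c≤j un) ⟩
    Σˢ j joinTerm ⊕ Σˢ j openTerm               ≈⟨ (λ n → sym (Σˢ-⊕ j joinTerm openTerm n)) ⟩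
    Σˢ j (λ x → joinTerm x ⊕ openTerm x)        ≈⟨ Σˢ-cong j (λ x n → sym (split ⌊ toℕ x ℕ.<? c ⌋ ⌊ toℕ x ℕ.≟ c ⌋ (exclusive x) n)) ⟩
    Σˢ j (λ x → branch c x (G c (bump p x)) (G (suc c) (bump p x)) 0ˢ) ∎
    where
    open ≈-Reasoning
    P : FPS
    P = Πˢ j (factor c p)
    Q : FPS
    Q = fresh (j ∸ c)
    joinTerm openTerm : Fin j → FPS
    joinTerm x = if ⌊ toℕ x ℕ.<? c ⌋ then G c (bump p x) else 0ˢ
    openTerm x = if ⌊ toℕ x ℕ.≟ c ⌋ then G (suc c) (bump p x) else 0ˢ
    joining : (D P ⊛ Q) ≗ Σˢ j joinTerm
    joining n = trans (⊛-congʳ Q (D-Πˢ j (factor c p)) n)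
                      (trans (⊛-Σˢʳ j (λ x → Πˢ j (updateAt (factor c p) x D)) Q n) (Σˢ-cong j (D-factor c p) n))
    exclusive : ∀ x → ⌊ toℕ x ℕ.<? c ⌋ ≡ true → ⌊ toℕ x ℕ.≟ c ⌋ ≡ false
    exclusive x lt = ⌊⌋-no (toℕ x ℕ.≟ c) (λ x≡c → ℕᵖ.<-irrefl x≡c (⌊⌋-sound (toℕ x ℕ.<? c) lt))
    split : ∀ {A B : FPS} b₁ b₂ → (b₁ ≡ true → b₂ ≡ false) →
      choose b₁ b₂ A B 0ˢ ≗ ((if b₁ then A else 0ˢ) ⊕ (if b₂ then B else 0ˢ))
    split {A} true  false _ n = sym (+-identityʳ (A n))
    split true  true  ex n with () ← ex refl
    split {B = B} false true  _ n = sym (+-identityˡ (B n))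
    split false false _ n = sym (+-identityʳ 0ℚ)

  private
    Πˢ-constant-term : ∀ k (fs : Fin k → FPS) (β : Fin k → Bool) → (∀ b → fs b 0 ≡ ℕtoℚ (ind (β b))) →
                       Πˢ k fs 0 ≡ ℕtoℚ (ind (all β (allFin k)))
    Πˢ-constant-term zero    fs β e = refl
    Πˢ-constant-term (suc k) fs β e = begin
      fs zero 0 * Πˢ k (λ b → fs (suc b)) 0                   ≡⟨ cong₂ _*_ (e zero) (Πˢ-constant-term k (λ b → fs (suc b)) (λ b → β (suc b)) (λ b → e (suc b))) ⟩
      ℕtoℚ (ind (β zero)) * ℕtoℚ (ind rest)                   ≡⟨ product (β zero) ⟩
      ℕtoℚ (ind (β zero ∧ rest))                              ≡⟨ cong (λ z → ℕtoℚ (ind z)) (sym (all-allFin-suc k β)) ⟩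
      ℕtoℚ (ind (all β (allFin (suc k))))                     ∎
      where
      open ≡-Reasoning
      rest : Bool
      rest = all (λ b → β (suc b)) (allFin k)
      product : ∀ β₀ → ℕtoℚ (ind β₀) * ℕtoℚ (ind rest) ≡ ℕtoℚ (ind (β₀ ∧ rest))
      product true  = *-identityˡ (ℕtoℚ (ind rest))
      product false = *-zeroˡ (ℕtoℚ (ind rest))

  -- Length 0: the empty word is admissible iff every block is already
  -- complete, which needs all blocks opened since S ∌ 0.
  N-egf-zero : ∀ c p → c ℕ.≤ j → Unopened c p → ℕtoℚ (N c p 0) * invFact 0 ≡ G c p 0
  N-egf-zero c p c≤j un with ℕᵖ.m≤n⇒m<n∨m≡n c≤j
  ... | inj₂ refl = begin
    ℕtoℚ (N c p 0) * 1ℚ                            ≡⟨ cong (λ z → ℕtoℚ z * 1ℚ) (count-[] c (admissible c p)) ⟩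
    ℕtoℚ (ind (all (λ b → S (p b ℕ.+ 0)) (allFin c))) * 1ℚ ≡⟨ *-identityʳ _ ⟩
    ℕtoℚ (ind (all (λ b → S (p b ℕ.+ 0)) (allFin c))) ≡⟨ sym (Πˢ-constant-term c (factor c p) (λ b → S (p b ℕ.+ 0)) opened-term) ⟩
    Πˢ c (factor c p) 0                            ≡⟨ sym (*-identityʳ _) ⟩
    Πˢ c (factor c p) 0 * 1ℚ                       ≡⟨ cong (λ q → Πˢ c (factor c p) 0 * fresh q 0) (sym (ℕᵖ.n∸n≡0 c)) ⟩
    G c p 0                                        ∎
    where
    open ≡-Reasoning
    opened-term : ∀ b → factor c p b 0 ≡ ℕtoℚ (ind (S (p b ℕ.+ 0)))
    opened-term b = trans (cong-app (factor-opened c p b (Finᵖ.toℕ<n b)) 0) (indicator (S (p b ℕ.+ 0)))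
      where
      indicator : ∀ β → (if β then invFact 0 else 0ℚ) ≡ ℕtoℚ (ind β)
      indicator true  = refl
      indicator false = refl
  ... | inj₁ c<j = begin
    ℕtoℚ (N c p 0) * invFact 0   ≡⟨ cong (λ z → ℕtoℚ z * invFact 0) (trans (count-[] j (admissible c p)) (cong ind empty-block)) ⟩
    0ℚ * invFact 0               ≡⟨ *-zeroˡ (invFact 0) ⟩
    0ℚ                           ≡⟨ sym (*-zeroʳ (Πˢ j (factor c p) 0)) ⟩
    Πˢ j (factor c p) 0 * 0ℚ     ≡⟨ cong (Πˢ j (factor c p) 0 *_) (sym fresh-zero) ⟩
    G c p 0                      ∎
    where
    open ≡-Reasoning
    x₀ : Fin j
    x₀ = fromℕ< c<j
    empty-block : all (λ b → S (p b ℕ.+ 0)) (allFin j) ≡ false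
    empty-block = all-allFin-false j _ x₀
      (trans (cong S (trans (ℕᵖ.+-identityʳ (p x₀)) (un x₀ (ℕᵖ.≤-reflexive (sym (Finᵖ.toℕ-fromℕ< c<j)))))) S0)
    fresh-zero : fresh (j ∸ c) 0 ≡ 0ℚ
    fresh-zero = trans (cong (λ q → fresh q 0) (ℕᵖ.+-∸-assoc 1 c<j))
      (trans (cong (λ β → invFact (suc (j ∸ suc c)) * ((if β then invFact 0 else 0ℚ) * (ES S ^ˢ (j ∸ suc c)) 0)) S0)
             (trans (cong (invFact (suc q) *_) (*-zeroˡ ((ES S ^ˢ q) 0))) (*-zeroʳ (invFact (suc q)))))
      where
      q : ℕ
      q = j ∸ suc c

  N-egf : ∀ m c p → c ℕ.≤ j → Unopened c p → ℕtoℚ (N c p m) * invFact m ≡ G c p m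
  N-egf zero    c p c≤j un = N-egf-zero c p c≤j un
  N-egf (suc m) c p c≤j un = ℕtoℚ-suc-cancel m (begin
    ℕtoℚ (suc m) * (ℕtoℚ (N c p (suc m)) * invFact (suc m))
      ≡⟨ swap (ℕtoℚ (suc m)) (ℕtoℚ (N c p (suc m))) (invFact (suc m)) ⟩
    ℕtoℚ (N c p (suc m)) * (ℕtoℚ (suc m) * invFact (suc m))
      ≡⟨ cong₂ _*_ (cong ℕtoℚ (N-suc c p m)) (invFact-suc m) ⟩
    ℕtoℚ (ℕΣ.sum T) * invFact m
      ≡⟨ cong (_* invFact m) (ℕtoℚ-sum j T) ⟩
    ℚΣ.sum (λ x → ℕtoℚ (T x)) * invFact m
      ≡⟨ ℚΣ.*-distribʳ-sum (invFact m) (λ x → ℕtoℚ (T x)) ⟩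
    ℚΣ.sum (λ x → ℕtoℚ (T x) * invFact m)
      ≡⟨ ℚΣ.sum-cong-≗ {j} (λ x → step x (toℕ x ℕ.<? c) (toℕ x ℕ.≟ c)) ⟩
    Σˢ j (λ x → branch c x (G c (bump p x)) (G (suc c) (bump p x)) 0ˢ) m
      ≡⟨ sym (D-G c p c≤j un m) ⟩
    ℕtoℚ (suc m) * G c p (suc m) ∎)
    where
    open ≡-Reasoning
    swap : ∀ (a x f : ℚ) → a * (x * f) ≡ x * (a * f)
    swap = solve-∀ ℚ-ring
    T : Fin j → ℕ
    T x = branch c x (N c (bump p x) m) (N (suc c) (bump p x) m) 0
    step : ∀ x (d₁ : Dec (toℕ x ℕ.< c)) (d₂ : Dec (toℕ x ≡ c)) →
      ℕtoℚ (choose ⌊ d₁ ⌋ ⌊ d₂ ⌋ (N c (bump p x) m) (N (suc c) (bump p x) m) 0) * invFact m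
        ≡ choose ⌊ d₁ ⌋ ⌊ d₂ ⌋ (G c (bump p x)) (G (suc c) (bump p x)) 0ˢ m
    step x (yes x<c) _        = N-egf m c (bump p x) c≤j (bump-unopened p x ℕᵖ.≤-refl x<c un)
    step x (no _)    (yes x≡c) = N-egf m (suc c) (bump p x) (subst (ℕ._< j) x≡c (Finᵖ.toℕ<n x))
                                      (bump-unopened p x (ℕᵖ.n≤1+n c) (ℕᵖ.≤-reflexive (cong suc x≡c)) un)
    step x (no _)    (no _)    = *-zeroˡ (invFact m)

module Words {j : ℕ} where
  open Decisions

  blockSize-++ : ∀ (A B : List (Fin j)) b → blockSize (A ++ B) b ≡ blockSize A b ℕ.+ blockSize B b
  blockSize-++ []      B b = refl
  blockSize-++ (x ∷ A) B b with ⌊ x Fin.≟ b ⌋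
  ... | true  = cong suc (blockSize-++ A B b)
  ... | false = blockSize-++ A B b

  absent-blockSize : ∀ (L : List (Fin j)) b → any (λ x → ⌊ x Fin.≟ b ⌋) L ≡ false → blockSize L b ≡ 0
  absent-blockSize []      b _ = refl
  absent-blockSize (x ∷ L) b e with ⌊ x Fin.≟ b ⌋
  absent-blockSize (x ∷ L) b () | true
  ... | false = absent-blockSize L b e

  private
    any-∈ : ∀ (p : Fin j → Bool) {z} (L : List (Fin j)) → z ∈ L → p z ≡ true → any p L ≡ true
    any-∈ p (y ∷ L) (here refl) pz = cong (_∨ any p L) pz
    any-∈ p (y ∷ L) (there z∈L) pz = trans (cong (p y ∨_) (any-∈ p L z∈L pz)) (Boolᵖ.∨-zeroʳ (p y))

    any-++ : ∀ (p : Fin j → Bool) (L M : List (Fin j)) → any p (L ++ M) ≡ any p L ∨ any p M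
    any-++ p []      M = refl
    any-++ p (y ∷ L) M = trans (cong (p y ∨_) (any-++ p L M)) (sym (Boolᵖ.∨-assoc (p y) (any p L) (any p M)))

  distinct-repeat : ∀ x (pre X : List (Fin j)) → x ∈ pre → distinct (pre ++ x ∷ X) ≡ false
  distinct-repeat x (y ∷ pre) X (here refl) = cong (λ z → not z ∧ distinct (pre ++ x ∷ X))
    (any-∈ (λ z → ⌊ x Fin.≟ z ⌋) (pre ++ x ∷ X) (∈-++⁺ʳ pre (here refl)) (⌊⌋-yes (x Fin.≟ x) refl))
  distinct-repeat x (y ∷ pre) X (there x∈pre) =
    trans (cong (not (any (λ z → ⌊ y Fin.≟ z ⌋) (pre ++ x ∷ X)) ∧_) (distinct-repeat x pre X x∈pre)) (Boolᵖ.∧-zeroʳ _)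

  distinct-snoc : ∀ x (pre : List (Fin j)) → distinct pre ≡ true → x ∉ pre → distinct (pre ++ x ∷ []) ≡ true
  distinct-snoc x []        _ _   = refl
  distinct-snoc x (y ∷ pre) d x∉ = cong₂ (λ a b → not a ∧ b) y-fresh (distinct-snoc x pre (Boolᵖ.∧-conicalʳ (not y∈pre) (distinct pre) d) (λ m → x∉ (there m)))
    where
    y∈pre : Bool
    y∈pre = any (λ z → ⌊ y Fin.≟ z ⌋) pre
    y-fresh : any (λ z → ⌊ y Fin.≟ z ⌋) (pre ++ x ∷ []) ≡ false
    y-fresh = trans (any-++ (λ z → ⌊ y Fin.≟ z ⌋) pre (x ∷ []))
      (cong₂ _∨_ (Boolᵖ.not-injective (Boolᵖ.∧-conicalˡ (not y∈pre) (distinct pre) d))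
                 (cong (_∨ false) (⌊⌋-no (y Fin.≟ x) (λ y≡x → x∉ (here (sym y≡x))))))

-- In a restricted-growth
-- word whose first r letters are pairwise distinct, those letters are
-- forced to be 0, 1, …, r-1; the remainder is an admissible continuation
-- with r blocks opened, each already holding one letter.  Surjectivity
-- comes for free because S ∌ 0.
module ForcedPrefix (S : Subset) (S0 : S 0 ≡ false) (j : ℕ) where
  open Counting
  open Decisions
  open AllFacts
  open Words
  open BlockGrowth S S0 j using (Profile; admissible; N; bump; bump-here; bump-elsewhere)

  sizesIn : List (Fin j) → Bool
  sizesIn L = all (λ b → S (blockSize L b)) (allFin j)

  partitionTest : ℕ → ∀ {m} → Vec (Fin j) m → Bool
  partitionTest r w = isRG w ∧ surj w ∧ distinct (take r (toList w)) ∧ sizesIn (toList w)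

  -- A block with no letter has size 0 ∉ S, so all block sizes in S forces surjectivity.
  surj-redundant : ∀ {m} (w : Vec (Fin j) m) → sizesIn (toList w) ≡ true → surj w ≡ true
  surj-redundant w = all-mono (allFin j) occupied
    where
    occupied : ∀ b → S (blockSize (toList w) b) ≡ true → any (λ x → ⌊ x Fin.≟ b ⌋) (toList w) ≡ true
    occupied b Sb with any (λ x → ⌊ x Fin.≟ b ⌋) (toList w) in absent
    ... | true  = refl
    ... | false with () ← trans (sym S0) (trans (cong S (sym (absent-blockSize (toList w) b absent))) Sb)

  partitionTest-without-surj : ∀ r {m} (w : Vec (Fin j) m) →
    partitionTest r w ≡ rgFrom 0 w ∧ (distinct (take r (toList w)) ∧ sizesIn (toList w))
  partitionTest-without-surj r w = drop (rgFrom 0 w) (surj w) (distinct (take r (toList w))) (sizesIn (toList w)) (surj-redundant w)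
    where
    drop : ∀ a s d q → (q ≡ true → s ≡ true) → a ∧ (s ∧ (d ∧ q)) ≡ a ∧ (d ∧ q)
    drop a s d true  q⇒s rewrite q⇒s refl = refl
    drop a s d false _   = cong (a ∧_) (trans (cong (s ∧_) (Boolᵖ.∧-zeroʳ d)) (trans (Boolᵖ.∧-zeroʳ s) (sym (Boolᵖ.∧-zeroʳ d))))

  record Seen (c : ℕ) (p : Profile) (pre : List (Fin j)) : Set where
    field
      complete : ∀ y → toℕ y ℕ.< c → y ∈ pre
      bounded  : ∀ y → y ∈ pre → toℕ y ℕ.< c
      nodup    : distinct pre ≡ true
      sizes    : ∀ b → p b ≡ blockSize pre b

  seen-[] : Seen 0 (λ _ → 0) []
  seen-[] = record { complete = λ _ (); bounded = λ _ (); nodup = refl; sizes = λ _ → refl }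

  seen-snoc : ∀ {c p pre} x → toℕ x ≡ c → Seen c p pre → Seen (suc c) (bump p x) (pre ++ x ∷ [])
  seen-snoc {c} {p} {pre} x x≡c s = record { complete = complete′ ; bounded = bounded′ ; nodup = nodup′ ; sizes = sizes′ }
    where
    open Seen s
    complete′ : ∀ y → toℕ y ℕ.< suc c → y ∈ pre ++ x ∷ []
    complete′ y y<1+c with ℕᵖ.m≤n⇒m<n∨m≡n (ℕᵖ.≤-pred y<1+c)
    ... | inj₁ y<c = ∈-++⁺ˡ (complete y y<c)
    ... | inj₂ y≡c = ∈-++⁺ʳ pre (here (Finᵖ.toℕ-injective (trans y≡c (sym x≡c))))
    bounded′ : ∀ y → y ∈ pre ++ x ∷ [] → toℕ y ℕ.< suc c
    bounded′ y y∈ with ∈-++⁻ pre y∈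
    ... | inj₁ y∈pre      = ℕᵖ.m<n⇒m<1+n (bounded y y∈pre)
    ... | inj₂ (here refl) = ℕᵖ.≤-reflexive (cong suc x≡c)
    nodup′ : distinct (pre ++ x ∷ []) ≡ true
    nodup′ = distinct-snoc x pre nodup (λ x∈pre → ℕᵖ.<-irrefl x≡c (bounded x x∈pre))
    sizes′ : ∀ b → bump p x b ≡ blockSize (pre ++ x ∷ []) b
    sizes′ b = trans (bumped (x Fin.≟ b)) (sym (blockSize-++ pre (x ∷ []) b))
      where
      bumped : (d : Dec (x ≡ b)) → (if ⌊ d ⌋ then suc (p b) else p b) ≡ blockSize pre b ℕ.+ (if ⌊ d ⌋ then 1 else 0)
      bumped (yes _) = trans (cong suc (sizes b)) (ℕᵖ.+-comm 1 (blockSize pre b))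
      bumped (no _)  = trans (sizes b) (sym (ℕᵖ.+-identityʳ _))

  forced : (t c : ℕ) → Profile → ∀ {n} → Vec (Fin j) (t ℕ.+ n) → Bool
  forced zero    c p w       = admissible c p w
  forced (suc t) c p (x ∷ w) = if ⌊ toℕ x ℕ.≟ c ⌋ then forced t (suc c) (bump p x) w else false

  -- Growth from c, distinctness of pre followed by t more letters, and block
  -- sizes in S together amount to the forced prefix followed by an
  -- admissible word: a repeated letter below c is never allowed.
  forced-correct : ∀ t c p pre {n} (v : Vec (Fin j) (t ℕ.+ n)) → Seen c p pre →
    rgFrom c v ∧ (distinct (pre ++ take t (toList v)) ∧ sizesIn (pre ++ toList v)) ≡ forced t c p v
  forced-correct zero c p pre v s = cong (rgFrom c v ∧_) (cong₂ _∧_ (trans (cong distinct (Listᵖ.++-identityʳ pre)) nodup)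
    (all-cong (allFin j) (λ b → cong S (trans (blockSize-++ pre (toList v) b) (cong (ℕ._+ blockSize (toList v) b) (sym (sizes b)))))))
    where open Seen s
  forced-correct (suc t) c p pre (x ∷ w) s = step (toℕ x ℕ.<? c) (toℕ x ℕ.≟ c)
    where
    open Seen s
    rest : Bool
    rest = distinct (pre ++ x ∷ take t (toList w)) ∧ sizesIn (pre ++ x ∷ toList w)
    step : (d₁ : Dec (toℕ x ℕ.< c)) (d₂ : Dec (toℕ x ≡ c)) →
      (if ⌊ d₁ ⌋ then rgFrom c w else if ⌊ d₂ ⌋ then rgFrom (suc c) w else false) ∧ rest
        ≡ (if ⌊ d₂ ⌋ then forced t (suc c) (bump p x) w else false)
    step (yes x<c) (yes x≡c) with () ← ℕᵖ.<-irrefl x≡c x<c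
    step (yes x<c) (no _)    = trans (cong (λ z → rgFrom c w ∧ (z ∧ sizesIn (pre ++ x ∷ toList w)))
                                           (distinct-repeat x pre (take t (toList w)) (complete x x<c)))
                                     (Boolᵖ.∧-zeroʳ (rgFrom c w))
    step (no _)    (yes x≡c) = trans (cong (rgFrom (suc c) w ∧_) regroup)
                                     (forced-correct t (suc c) (bump p x) (pre ++ x ∷ []) w (seen-snoc x x≡c s))
      where
      regroup : rest ≡ distinct ((pre ++ x ∷ []) ++ take t (toList w)) ∧ sizesIn ((pre ++ x ∷ []) ++ toList w)
      regroup = sym (cong₂ (λ A B → distinct A ∧ sizesIn B)
                           (Listᵖ.++-assoc pre (x ∷ []) (take t (toList w))) (Listᵖ.++-assoc pre (x ∷ []) (toList w)))
    step (no _)    (no _)    = refl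

  bumpAt : Profile → ℕ → Profile
  bumpAt p c b = if ⌊ toℕ b ℕ.≟ c ⌋ then suc (p b) else p b

  afterPrefix : ℕ → ℕ → Profile → Profile
  afterPrefix zero    c p = p
  afterPrefix (suc t) c p = afterPrefix t (suc c) (bumpAt p c)

  bump-bumpAt : ∀ p x c → toℕ x ≡ c → ∀ b → bump p x b ≡ bumpAt p c b
  bump-bumpAt p x c x≡c b = cong (λ β → if β then suc (p b) else p b) (agree (x Fin.≟ b) (toℕ b ℕ.≟ c))
    where
    agree : (d₁ : Dec (x ≡ b)) (d₂ : Dec (toℕ b ≡ c)) → ⌊ d₁ ⌋ ≡ ⌊ d₂ ⌋
    agree (yes _)    (yes _)   = refl
    agree (yes refl) (no b≢c)  with () ← b≢c x≡c
    agree (no x≢b)   (yes b≡c) with () ← x≢b (Finᵖ.toℕ-injective (trans x≡c (sym b≡c)))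
    agree (no _)     (no _)    = refl

  private
    module ℕPick = Pick ℕᵖ.+-*-semiring

    admissible-cong : ∀ c {p p'} → (∀ b → p b ≡ p' b) → ∀ {m} (w : Vec (Fin j) m) → admissible c p w ≡ admissible c p' w
    admissible-cong c e w = cong (rgFrom c w ∧_) (all-cong (allFin j) (λ b → cong (λ a → S (a ℕ.+ blockSize (toList w) b)) (e b)))

    forced-cong : ∀ t c {p p'} → (∀ b → p b ≡ p' b) → ∀ {n} (v : Vec (Fin j) (t ℕ.+ n)) → forced t c p v ≡ forced t c p' v
    forced-cong zero    c e v       = admissible-cong c e v
    forced-cong (suc t) c e (x ∷ w) = cong (λ z → if ⌊ toℕ x ℕ.≟ c ⌋ then z else false)
      (forced-cong t (suc c) (λ b → cong (λ a → if ⌊ x Fin.≟ b ⌋ then suc a else a) (e b)) w)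

  -- Only the forced letter contributes at each of the first t positions.
  count-forced : ∀ t c p {n} → t ℕ.+ c ℕ.≤ j → count (t ℕ.+ n) j (forced t c p) ≡ N (t ℕ.+ c) (afterPrefix t c p) n
  count-forced zero    c p t+c≤j = refl
  count-forced (suc t) c p {n} t+c≤j = begin
    count (suc t ℕ.+ n) j (forced (suc t) c p)
      ≡⟨ count-suc (t ℕ.+ n) j (forced (suc t) c p) ⟩
    ℕΣ.sum (λ x → count (t ℕ.+ n) j (λ w → forced (suc t) c p (x ∷ w)))
      ≡⟨ ℕΣ.sum-cong-≗ {j} (λ x → count-if ⌊ toℕ x ℕ.≟ c ⌋ (forced t (suc c) (bump p x))) ⟩
    ℕΣ.sum (ℕPick.pick c (λ x → count (t ℕ.+ n) j (forced t (suc c) (bump p x))))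
      ≡⟨ ℕPick.sum-pick c c<j (λ x → count (t ℕ.+ n) j (forced t (suc c) (bump p x))) ⟩
    count (t ℕ.+ n) j (forced t (suc c) (bump p x₀))
      ≡⟨ count-cong (t ℕ.+ n) j (forced-cong t (suc c) (bump-bumpAt p x₀ c (Finᵖ.toℕ-fromℕ< c<j))) ⟩
    count (t ℕ.+ n) j (forced t (suc c) (bumpAt p c))
      ≡⟨ count-forced t (suc c) (bumpAt p c) (subst (ℕ._≤ j) (sym (ℕᵖ.+-suc t c)) t+c≤j) ⟩
    N (t ℕ.+ suc c) (afterPrefix t (suc c) (bumpAt p c)) n
      ≡⟨ cong (λ z → N z (afterPrefix t (suc c) (bumpAt p c)) n) (ℕᵖ.+-suc t c) ⟩
    N (suc t ℕ.+ c) (afterPrefix (suc t) c p) n ∎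
    where
    open ≡-Reasoning
    c<j : c ℕ.< j
    c<j = ℕᵖ.<-≤-trans (s≤s (ℕᵖ.m≤n+m c t)) t+c≤j
    x₀ : Fin j
    x₀ = fromℕ< c<j
    count-if : ∀ β (P : Vec (Fin j) (t ℕ.+ n) → Bool) → count (t ℕ.+ n) j (λ w → if β then P w else false) ≡ (if β then count (t ℕ.+ n) j P else 0)
    count-if true  P = refl
    count-if false P = count-false (t ℕ.+ n) j

  private
    bumpAt-elsewhere : ∀ p c b → toℕ b ≢ c → bumpAt p c b ≡ p b
    bumpAt-elsewhere p c b b≢c = cong (λ β → if β then suc (p b) else p b) (⌊⌋-no (toℕ b ℕ.≟ c) b≢c)

  afterPrefix-below : ∀ t c p b → toℕ b ℕ.< c → afterPrefix t c p b ≡ p b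
  afterPrefix-below zero    c p b b<c = refl
  afterPrefix-below (suc t) c p b b<c = trans (afterPrefix-below t (suc c) (bumpAt p c) b (ℕᵖ.m<n⇒m<1+n b<c))
                                              (bumpAt-elsewhere p c b (λ b≡c → ℕᵖ.<-irrefl b≡c b<c))

  afterPrefix-above : ∀ t c p b → t ℕ.+ c ℕ.≤ toℕ b → afterPrefix t c p b ≡ p b
  afterPrefix-above zero    c p b _ = refl
  afterPrefix-above (suc t) c p b t+c≤b = trans (afterPrefix-above t (suc c) (bumpAt p c) b (subst (ℕ._≤ toℕ b) (sym (ℕᵖ.+-suc t c)) t+c≤b))
    (bumpAt-elsewhere p c b (λ b≡c → ℕᵖ.<-irrefl (sym b≡c) (ℕᵖ.<-≤-trans (s≤s (ℕᵖ.m≤n+m c t)) t+c≤b)))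

  afterPrefix-inside : ∀ t c p b → c ℕ.≤ toℕ b → toℕ b ℕ.< t ℕ.+ c → afterPrefix t c p b ≡ suc (p b)
  afterPrefix-inside zero    c p b c≤b b<c with () ← ℕᵖ.<-irrefl refl (ℕᵖ.<-≤-trans b<c c≤b)
  afterPrefix-inside (suc t) c p b c≤b b<t+c with ℕᵖ.m≤n⇒m<n∨m≡n c≤b
  ... | inj₂ c≡b = trans (afterPrefix-below t (suc c) (bumpAt p c) b (ℕᵖ.≤-reflexive (cong suc (sym c≡b))))
                         (cong (λ β → if β then suc (p b) else p b) (⌊⌋-yes (toℕ b ℕ.≟ c) (sym c≡b)))
  ... | inj₁ c<b = trans (afterPrefix-inside t (suc c) (bumpAt p c) b c<b (subst (toℕ b ℕ.<_) (sym (ℕᵖ.+-suc t c)) b<t+c))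
                         (cong suc (bumpAt-elsewhere p c b (λ b≡c → ℕᵖ.<-irrefl (sym b≡c) c<b)))

-- Column generating function of the (S,r)-Stirling numbers:
--   Σ_n {n brace k}_{S,r} tⁿ/n! = E_{S-1}(t)^r · E_S(t)^k / k!,
-- obtained from N-egf with the r forced blocks opened, each holding one
-- letter (so that its completion series is T₁ = E_{S-1}).
module StirlingColumn (S : Subset) (S0 : S 0 ≡ false) (k r : ℕ) where
  open Series
  open FinSums using (Πˢ; Πˢ-cong; Πˢ-power)
  open Counting
  open BlockGrowth S S0 (k ℕ.+ r)
  open ForcedPrefix S S0 (k ℕ.+ r)

  opened : Profile
  opened = afterPrefix r 0 (λ _ → 0)

  private
    r≤j : r ℕ.≤ k ℕ.+ r
    r≤j = ℕᵖ.m≤n+m r k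

  stirling-count : ∀ n → stirlingSr S r n k ≡ N r opened n
  stirling-count n = begin
    stirlingSr S r n k
      ≡⟨ cong (λ m → count m (k ℕ.+ r) (partitionTest r)) (ℕᵖ.+-comm n r) ⟩
    count (r ℕ.+ n) (k ℕ.+ r) (partitionTest r)
      ≡⟨ count-cong (r ℕ.+ n) (k ℕ.+ r) (λ v → trans (partitionTest-without-surj r v) (forced-correct r 0 (λ _ → 0) [] v seen-[])) ⟩
    count (r ℕ.+ n) (k ℕ.+ r) (forced r 0 (λ _ → 0))
      ≡⟨ count-forced r 0 (λ _ → 0) (subst (ℕ._≤ k ℕ.+ r) (sym (ℕᵖ.+-identityʳ r)) r≤j) ⟩
    N (r ℕ.+ 0) opened n
      ≡⟨ cong (λ c → N c opened n) (ℕᵖ.+-identityʳ r) ⟩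
    N r opened n ∎
    where open ≡-Reasoning

  opened-unopened : Unopened r opened
  opened-unopened b r≤b = afterPrefix-above r 0 (λ _ → 0) b (subst (ℕ._≤ toℕ b) (sym (ℕᵖ.+-identityʳ r)) r≤b)

  opened-factor : ∀ b → factor r opened b ≗ (if ⌊ toℕ b ℕ.<? r ⌋ then completion 1 else 1ˢ)
  opened-factor b = caseOn (toℕ b ℕ.<? r)
    where
    caseOn : (d : Dec (toℕ b ℕ.< r)) → factor r opened b ≗ (if ⌊ d ⌋ then completion 1 else 1ˢ)
    caseOn (yes b<r) = cong-app (trans (factor-opened r opened b b<r)
                                     (cong completion (afterPrefix-inside r 0 (λ _ → 0) b z≤n (subst (toℕ b ℕ.<_) (sym (ℕᵖ.+-identityʳ r)) b<r))))
    caseOn (no  b≮r) = cong-app (factor-unopened r opened b b≮r)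

  stirling-egf : ∀ n → ℕtoℚ (stirlingSr S r n k) * invFact n ≡ invFact k * ((ESm1 S ^ˢ r) ⊛ (ES S ^ˢ k)) n
  stirling-egf n = begin
    ℕtoℚ (stirlingSr S r n k) * invFact n ≡⟨ cong (λ z → ℕtoℚ z * invFact n) (stirling-count n) ⟩
    ℕtoℚ (N r opened n) * invFact n       ≡⟨ N-egf n r opened r≤j opened-unopened ⟩
    G r opened n                          ≡⟨ ⊛-cong opened-product (λ m → cong (λ q → fresh q m) (ℕᵖ.m+n∸n≡m k r)) n ⟩
    ((ESm1 S ^ˢ r) ⊛ fresh k) n           ≡⟨ ⊛-·ˢʳ (invFact k) (ESm1 S ^ˢ r) (ES S ^ˢ k) n ⟩
    invFact k * ((ESm1 S ^ˢ r) ⊛ (ES S ^ˢ k)) n ∎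
    where
    open ≡-Reasoning
    opened-product : Πˢ (k ℕ.+ r) (factor r opened) ≗ (ESm1 S ^ˢ r)
    opened-product m = trans (Πˢ-cong (k ℕ.+ r) opened-factor m) (Πˢ-power (k ℕ.+ r) r (completion 1) r≤j m)

module Substitution where
  open Series
  open RangeSums
  open Signs

  atNeg-cong : ∀ {f g} → f ≗ g → atNeg f ≗ atNeg g
  atNeg-cong p n = cong (sgn n *_) (p n)

  -- t ↦ -t is multiplicative, since (-1)^i (-1)^(n-i) = (-1)^n.
  atNeg-⊛ : ∀ f g → (atNeg f ⊛ atNeg g) ≗ atNeg (f ⊛ g)
  atNeg-⊛ f g n = trans (sumTo-cong≤ n (λ i i≤n → trans (regroup (sgn i) (f i) (sgn (n ∸ i)) (g (n ∸ i)))
      (cong (_* (f i * g (n ∸ i))) (trans (sym (sgn-+ i (n ∸ i))) (cong sgn (ℕᵖ.m+[n∸m]≡n i≤n))))))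
    (sumTo-*ˡ n (sgn n) (λ i → f i * g (n ∸ i)))
    where
    regroup : ∀ (a f b g : ℚ) → (a * f) * (b * g) ≡ (a * b) * (f * g)
    regroup = solve-∀ ℚ-ring

  atNeg-^ˢ : ∀ f k → (atNeg f ^ˢ k) ≗ atNeg (f ^ˢ k)
  atNeg-^ˢ f zero    zero    = refl
  atNeg-^ˢ f zero    (suc n) = sym (*-zeroʳ (sgn (suc n)))
  atNeg-^ˢ f (suc k) n       = trans (⊛-congˡ (atNeg f) (atNeg-^ˢ f k) n) (atNeg-⊛ f (f ^ˢ k) n)

  negS-atNeg : ∀ h → negS (atNeg h) ≗ atNeg (negS h)
  negS-atNeg h n = ℚᵖ.neg-distribʳ-* (sgn n) (h n)

  negS-^ˢ : ∀ h k → (negS h ^ˢ k) ≗ (sgn k ·ˢ (h ^ˢ k))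
  negS-^ˢ h zero    zero    = refl
  negS-^ˢ h zero    (suc n) = refl
  negS-^ˢ h (suc k) n = begin
    (negS h ⊛ (negS h ^ˢ k)) n              ≡⟨ ⊛-congˡ (negS h) (negS-^ˢ h k) n ⟩
    (negS h ⊛ (sgn k ·ˢ (h ^ˢ k))) n        ≡⟨ ⊛-·ˢʳ (sgn k) (negS h) (h ^ˢ k) n ⟩
    sgn k * (negS h ⊛ (h ^ˢ k)) n           ≡⟨ cong (sgn k *_) (sumTo-cong n (λ i → sym (ℚᵖ.neg-distribˡ-* (h i) ((h ^ˢ k) (n ∸ i))))) ⟩
    sgn k * sumTo n (λ i → - (h i * (h ^ˢ k) (n ∸ i)))
                                            ≡⟨ cong (sgn k *_) (neg-sumTo n (λ i → h i * (h ^ˢ k) (n ∸ i))) ⟩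
    sgn k * - (h ^ˢ suc k) n                ≡⟨ sym (ℚᵖ.neg-distribʳ-* (sgn k) _) ⟩
    - (sgn k * (h ^ˢ suc k) n)              ≡⟨ ℚᵖ.neg-distribˡ-* (sgn k) _ ⟩
    - sgn k * (h ^ˢ suc k) n                ≡⟨ cong (_* (h ^ˢ suc k) n) (sym (sgn-suc k)) ⟩
    sgn (suc k) * (h ^ˢ suc k) n            ∎
    where
    open ≡-Reasoning
    neg-sumTo : ∀ n (f : ℕ → ℚ) → sumTo n (λ i → - f i) ≡ - sumTo n f
    neg-sumTo n f = trans (sumTo-cong n (λ i → minus-one (f i))) (trans (sumTo-*ˡ n (- 1ℚ) f) (sym (minus-one (sumTo n f))))
      where
      minus-one : ∀ (x : ℚ) → - x ≡ (- 1ℚ) * x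
      minus-one = solve-∀ ℚ-ring

  ^ˢ-order : ∀ g → g 0 ≡ 0ℚ → ∀ k m → m ℕ.< k → (g ^ˢ k) m ≡ 0ℚ
  ^ˢ-order g g0 (suc k) m m<1+k = sumTo-zero m term
    where
    term : ∀ i → i ℕ.≤ m → g i * (g ^ˢ k) (m ∸ i) ≡ 0ℚ
    term zero    _   = trans (cong (_* (g ^ˢ k) m) g0) (*-zeroˡ ((g ^ˢ k) m))
    term (suc i) i≤m = trans (cong (g (suc i) *_) (^ˢ-order g g0 k (m ∸ suc i)
        (ℕᵖ.<-≤-trans (ℕᵖ.∸-monoʳ-< {o = 0} (s≤s z≤n) i≤m) (ℕᵖ.≤-pred m<1+k)))) (*-zeroʳ (g (suc i)))

  compose-truncate : ∀ a g → g 0 ≡ 0ℚ → ∀ {m n} → m ℕ.≤ n → compose a g m ≡ sumTo n (λ k → a k * (g ^ˢ k) m)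
  compose-truncate a g g0 m≤n = sym (sumTo-truncate _ _ m≤n (λ k m<k _ → trans (cong (a k *_) (^ˢ-order g g0 k _ m<k)) (*-zeroʳ (a k))))

-- Writing
-- X n k = [tⁿ] E_{S-1}(t)^r E_S(t)^k, the k-th summand of each side of
-- [tⁿ] is (k+1)^{-μ} (-1)^n (-1)^k X n k: on the left by the column
-- generating function of the Stirling numbers, on the right because
-- t ↦ -t and f ↦ -f contribute the signs (-1)^n and (-1)^k.
module PolyBernoulliEGF (S : Subset) (S0 : S 0 ≡ false) (r : ℕ) (μ : ℤ) where
  open Series
  open RangeSums
  open Signs
  open Substitution

  A : FPS
  A = atNeg (ESm1 S) ^ˢ r

  g : FPS
  g = negS (atNeg (ES S))

  X : ℕ → ℕ → ℚ
  X n k = ((ESm1 S ^ˢ r) ⊛ (ES S ^ˢ k)) n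

  summand : ℕ → ℕ → ℚ
  summand n k = LiOverU μ k * (sgn n * (sgn k * X n k))

  A⊛g^k : ∀ n k → (A ⊛ (g ^ˢ k)) n ≡ sgn n * (sgn k * X n k)
  A⊛g^k n k = begin
    (A ⊛ (g ^ˢ k)) n                                          ≡⟨ ⊛-cong (atNeg-^ˢ (ESm1 S) r) g^k n ⟩
    (atNeg (ESm1 S ^ˢ r) ⊛ atNeg (sgn k ·ˢ (ES S ^ˢ k))) n     ≡⟨ atNeg-⊛ (ESm1 S ^ˢ r) (sgn k ·ˢ (ES S ^ˢ k)) n ⟩
    sgn n * ((ESm1 S ^ˢ r) ⊛ (sgn k ·ˢ (ES S ^ˢ k))) n         ≡⟨ cong (sgn n *_) (⊛-·ˢʳ (sgn k) (ESm1 S ^ˢ r) (ES S ^ˢ k) n) ⟩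
    sgn n * (sgn k * X n k)                                   ∎
    where
    open ≡-Reasoning
    g^k : (g ^ˢ k) ≗ atNeg (sgn k ·ˢ (ES S ^ˢ k))
    g^k m = trans (^ˢ-cong k (negS-atNeg (ES S)) m)
              (trans (atNeg-^ˢ (negS (ES S)) k m) (atNeg-cong (negS-^ˢ (ES S) k) m))

  rhs-expansion : ∀ n → (A ⊛ compose (LiOverU μ) g) n ≡ sumTo n (summand n)
  rhs-expansion n = begin
    sumTo n (λ i → A i * compose L g (n ∸ i))
      ≡⟨ sumTo-cong n (λ i → cong (A i *_) (compose-truncate L g g0 (ℕᵖ.m∸n≤m n i))) ⟩
    sumTo n (λ i → A i * sumTo n (λ k → L k * (g ^ˢ k) (n ∸ i)))
      ≡⟨ sumTo-cong n (λ i → sym (sumTo-*ˡ n (A i) (λ k → L k * (g ^ˢ k) (n ∸ i)))) ⟩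
    sumTo n (λ i → sumTo n (λ k → A i * (L k * (g ^ˢ k) (n ∸ i))))
      ≡⟨ sumTo-swap n n (λ i k → A i * (L k * (g ^ˢ k) (n ∸ i))) ⟩
    sumTo n (λ k → sumTo n (λ i → A i * (L k * (g ^ˢ k) (n ∸ i))))
      ≡⟨ sumTo-cong n (λ k → trans (sumTo-cong n (λ i → swap (A i) (L k) ((g ^ˢ k) (n ∸ i))))
                                   (sumTo-*ˡ n (L k) (λ i → A i * (g ^ˢ k) (n ∸ i)))) ⟩
    sumTo n (λ k → L k * (A ⊛ (g ^ˢ k)) n)
      ≡⟨ sumTo-cong n (λ k → cong (L k *_) (A⊛g^k n k)) ⟩
    sumTo n (summand n) ∎
    where
    open ≡-Reasoning
    L : FPS
    L = LiOverU μ
    g0 : g 0 ≡ 0ℚ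
    g0 = cong (λ z → - (1ℚ * (if z then invFact 0 else 0ℚ))) S0
    swap : ∀ (a l y : ℚ) → a * (l * y) ≡ l * (a * y)
    swap = solve-∀ ℚ-ring

  -- Left side: the k-th term of B_n/n!, by the column EGF; k! cancels 1/k!.
  lhs-term : ∀ n k → k ℕ.≤ n →
    ℕtoℚ (stirlingSr S r n k) * sgn (n ∸ k) * ℕtoℚ (k !) * invPow k μ * invFact n ≡ summand n k
  lhs-term n k k≤n = begin
    N * sgn (n ∸ k) * ℕtoℚ (k !) * invPow k μ * invFact n
      ≡⟨ regroup N (sgn (n ∸ k)) (ℕtoℚ (k !)) (invPow k μ) (invFact n) ⟩
    invPow k μ * (sgn (n ∸ k) * (ℕtoℚ (k !) * (N * invFact n)))
      ≡⟨ cong (λ z → invPow k μ * (sgn (n ∸ k) * (ℕtoℚ (k !) * z))) (StirlingColumn.stirling-egf S S0 k r n) ⟩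
    invPow k μ * (sgn (n ∸ k) * (ℕtoℚ (k !) * (invFact k * X n k)))
      ≡⟨ cong (λ z → invPow k μ * (sgn (n ∸ k) * z)) cancel-factorial ⟩
    invPow k μ * (sgn (n ∸ k) * X n k)
      ≡⟨ cong (λ z → invPow k μ * (z * X n k)) (sgn-∸ n k k≤n) ⟩
    invPow k μ * ((sgn n * sgn k) * X n k)
      ≡⟨ cong (invPow k μ *_) (*-assoc (sgn n) (sgn k) (X n k)) ⟩
    summand n k ∎
    where
    open ≡-Reasoning
    N : ℚ
    N = ℕtoℚ (stirlingSr S r n k)
    regroup : ∀ (t s K c i : ℚ) → t * s * K * c * i ≡ c * (s * (K * (t * i)))
    regroup = solve-∀ ℚ-ring
    cancel-factorial : ℕtoℚ (k !) * (invFact k * X n k) ≡ X n k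
    cancel-factorial = trans (sym (*-assoc (ℕtoℚ (k !)) (invFact k) (X n k)))
                             (trans (cong (_* X n k) (Embedding.fact-invFact k)) (*-identityˡ (X n k)))

mainTheorem18 : (S : Subset) → S 0 ≡ false → (r : ℕ) (μ : ℤ) → (n : ℕ) →
    egf (polyBernoulli S r μ) n
      ≡ ((atNeg (ESm1 S) ^ˢ r) ⊛ compose (LiOverU μ) (negS (atNeg (ES S)))) n
mainTheorem18 S S0 r μ n = begin
  egf (polyBernoulli S r μ) n
    ≡⟨ sym (sumTo-*ʳ n (invFact n) stirlingTerm) ⟩
  sumTo n (λ k → stirlingTerm k * invFact n)
    ≡⟨ sumTo-cong≤ n (lhs-term n) ⟩
  sumTo n (summand n)
    ≡⟨ sym (rhs-expansion n) ⟩
  ((atNeg (ESm1 S) ^ˢ r) ⊛ compose (LiOverU μ) (negS (atNeg (ES S)))) n ∎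
  where
  open ≡-Reasoning
  open RangeSums using (sumTo-*ʳ; sumTo-cong≤)
  open PolyBernoulliEGF S S0 r μ using (summand; lhs-term; rhs-expansion)
  stirlingTerm : ℕ → ℚ
  stirlingTerm k = ℕtoℚ (stirlingSr S r n k) * sgn (n ∸ k) * ℕtoℚ (k !) * invPow k μ
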